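{- Let $p$ be a prime and $\mathcal{D}=(H,x,y)$ a symmetric $p$-dessin, and let $G$ be its extended automorphism group. Then $G$ is supersolvable. Moreover, $G$ is nilpotent if and only if either $p=2$, or $p>2$ and $G\cong\mathbb{Z}_{p^e}\oplus\mathbb{Z}_2$ for some $e\ge0$.
   Context: A regular dessin is a triple $(H,x,y)$ with $H$ a finite group generated by $x,y$; it is a $p$-dessin if $H$ is a $p$-group, and symmetric if the assignment $x\mapsto y$, $y\mapsto x$ extends to an automorphism $\tau$ of $H$. The extended automorphism group of a symmetric dessin is defined as the semidirect product $H\rtimes\langle\tau\rangle$ when $x\ne y$ (so $\tau$ has order 2), and as $\langle x,L\mid x^{m}=L^2=[x,L]=1\rangle\cong\mathbb{Z}_m\oplus\mathbb{Z}_2$ with $m=o(x)$ when $x=y$. A finite group is supersolvable if it has a series $1=N_0\le N_1\le\dots\le N_s=G$ of normal subgroups of $G$ with all factors $N_i/N_{i-1}$ cyclic. -}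

module Defs where

open import Level using (0ℓ)
open import Data.Nat using (ℕ; zero; suc; _+_; _∸_; _<_)
open import Data.Nat.DivMod using (_mod_)
open import Data.Integer as ℤ using (ℤ; +_; -[1+_])
open import Data.Fin using (Fin; toℕ)
open import Data.Bool using (Bool; true; false; _xor_)
open import Data.Product using (Σ; ∃; _×_; _,_)
open import Data.List using (List; []; _∷_)
open import Relation.Binary.PropositionalEquality using (_≡_; _≢_)
open import Function.Bundles using (_↔_; Inverse)

record RawGrp : Set₁ where
  infixl 7 _∙_
  field
    Carrier : Set
    _∙_     : Carrier → Carrier → Carrier
    ε       : Carrier
    _⁻¹     : Carrier → Carrier

record Grp : Set₁ where
  field
    raw : RawGrp
  open RawGrp raw public
  field
    assoc     : ∀ a b c → (a ∙ b) ∙ c ≡ a ∙ (b ∙ c)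
    identityˡ : ∀ a → ε ∙ a ≡ a
    identityʳ : ∀ a → a ∙ ε ≡ a
    inverseˡ  : ∀ a → (a ⁻¹) ∙ a ≡ ε
    inverseʳ  : ∀ a → a ∙ (a ⁻¹) ≡ ε

module _ (G : RawGrp) where
  open RawGrp G

  pow : Carrier → ℕ → Carrier
  pow g zero    = ε
  pow g (suc n) = g ∙ pow g n

  zpow : Carrier → ℤ → Carrier
  zpow g (+ n)      = pow g n
  zpow g -[1+ n ]   = pow (g ⁻¹) (suc n)

  Subset : Set₁
  Subset = Carrier → Set

  IsNormalSubgroup : Subset → Set
  IsNormalSubgroup N =
    N ε × (∀ a b → N a → N b → N (a ∙ b)) × (∀ a → N a → N (a ⁻¹))
      × (∀ g a → N a → N ((g ∙ a) ∙ (g ⁻¹)))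

  IsNormalSeries : (s : ℕ) → (ℕ → Subset) → Set
  IsNormalSeries s N =
    (∀ i → IsNormalSubgroup (N i))
      × (∀ a → N 0 a → a ≡ ε)
      × (∀ a → N s a)
      × (∀ i → i < s → ∀ a → N i a → N (suc i) a)

  -- G is supersolvable: a normal series with all factors N (i+1) / N i cyclic
  Supersolvable : Set₁
  Supersolvable =
    Σ ℕ λ s → Σ (ℕ → Subset) λ N → IsNormalSeries s N ×
      (∀ i → i < s → Σ Carrier λ g → N (suc i) g ×
        (∀ h → N (suc i) h → Σ ℤ λ z → N i ((zpow g z ⁻¹) ∙ h)))

  -- G is nilpotent: it has a central series, i.e. a normal series with
  -- N (i+1) / N i ≤ Z (G / N i), i.e. [g , h] ∈ N i for all g ∈ G, h ∈ N (i+1)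
  Nilpotent : Set₁
  Nilpotent =
    Σ ℕ λ s → Σ (ℕ → Subset) λ N → IsNormalSeries s N ×
      (∀ i → i < s → ∀ g h → N (suc i) h →
         N i ((((g ⁻¹) ∙ (h ⁻¹)) ∙ g) ∙ h))

_≅_ : RawGrp → RawGrp → Set
G ≅ K = Σ (RawGrp.Carrier G ↔ RawGrp.Carrier K) λ f →
  ∀ a b → Inverse.to f (RawGrp._∙_ G a b)
          ≡ RawGrp._∙_ K (Inverse.to f a) (Inverse.to f b)

-- The group ℤ_{suc k} ⊕ ℤ_2  (written additively on Fin (suc k) × Bool)

CycZ2 : (k : ℕ) → RawGrp
CycZ2 k = record
  { Carrier = Fin (suc k) × Bool
  ; _∙_     = λ { (a , s) (b , t) → ((toℕ a + toℕ b) mod (suc k)) , (s xor t) }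
  ; ε       = (0 mod (suc k)) , false
  ; _⁻¹     = λ { (a , s) → ((suc k ∸ toℕ a) mod (suc k)) , s }
  }

IsoCycZ2 : RawGrp → ℕ → Set
IsoCycZ2 G n = Σ ℕ λ k → (suc k ≡ n) × (G ≅ CycZ2 k)

module _ (H : Grp) where
  open Grp H

  data Letter : Set where
    X Y X⁻ Y⁻ : Letter

  evalWord : Carrier → Carrier → List Letter → Carrier
  evalWord x y []        = ε
  evalWord x y (X ∷ w)   = x ∙ evalWord x y w
  evalWord x y (Y ∷ w)   = y ∙ evalWord x y w
  evalWord x y (X⁻ ∷ w)  = (x ⁻¹) ∙ evalWord x y w
  evalWord x y (Y⁻ ∷ w)  = (y ⁻¹) ∙ evalWord x y w

  Generates : Carrier → Carrier → Set
  Generates x y = ∀ h → ∃ λ w → evalWord x y w ≡ h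

  IsAutomorphism : (Carrier → Carrier) → Set
  IsAutomorphism τ =
    (∀ a b → τ (a ∙ b) ≡ τ a ∙ τ b) ×
    Σ (Carrier → Carrier) λ σ → (∀ a → σ (τ a) ≡ a) × (∀ a → τ (σ a) ≡ a)

  IsOrder : Carrier → ℕ → Set
  IsOrder x m = (0 < m) × (pow raw x m ≡ ε) ×
    (∀ j → 0 < j → j < m → pow raw x j ≢ ε)

  -- semidirect product H ⋊ ⟨τ⟩ with τ of order 2; carrier H × Bool,
  -- (h , a)(k , b) = (h τ^a(k) , a + b)
  Semidirect : (Carrier → Carrier) → RawGrp
  Semidirect τ = record
    { Carrier = Carrier × Bool
    ; _∙_     = λ { (h , a) (k , b) → (h ∙ τpow a k) , (a xor b) }
    ; ε       = ε , false
    ; _⁻¹     = λ { (h , a) → τpow a (h ⁻¹) , a }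
    }
    where
      τpow : Bool → Carrier → Carrier
      τpow false k = k
      τpow true  k = τ k

module Submission where

-- If x = y then G = ℤ_m ⊕ ℤ_2 with m = o(x): it is abelian (so supersolvable
-- and nilpotent) and m ∣ |H| makes m a power of p.  If x ≠ y then τ is an
-- involution moving x and G = H ⋊ ⟨τ⟩.  Using the class equation, H has a
-- τ-invariant series 1 = M 0 ≤ M 1 ≤ … ≤ M n = H whose factors M (i+1)/M i
-- are cyclic, central in H/M i and generated by some g with τ g ≡ g^(±1);
-- together with G/H ≅ ℤ_2 this makes G supersolvable.  For p = 2 we have
-- g ≡ g⁻¹, so the series is central in G; for odd p the commutator
-- [τ, h] = τ(h)⁻¹ h cannot vanish in a central series unless τ = 1.

open import Defs
open import Data.Nat using (ℕ; suc; _^_; _>_)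
open import Data.Nat.Primality using (Prime)
open import Data.Fin using (Fin)
open import Data.Product using (Σ; _×_)
open import Data.Sum using (_⊎_)
open import Relation.Binary.PropositionalEquality using (_≡_; _≢_)
open import Function.Bundles using (_↔_; _⇔_)
open import Data.Nat using (_+_; _*_)
open import Data.List using (List)
open import Data.List.Membership.Propositional using (_∈_)
open import Data.List.Relation.Unary.Unique.Propositional using (Unique)
open import Relation.Nullary using (Dec)

module Arithmetic where

  open import Data.Nat
  open import Data.Nat.Properties
  open import Data.Nat.Divisibility
  open import Data.Nat.DivMod
  open import Data.Nat.Primality
  open import Data.Nat.Coprimality using (Coprime; coprime-divisor)
  open import Data.Product using (Σ; _×_; _,_)
  open import Data.Sum using (_⊎_; inj₁; inj₂)
  open import Data.Empty using (⊥-elim)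
  open import Relation.Nullary using (¬_; Dec; yes; no)
  open import Relation.Binary.PropositionalEquality

  least : (Q : ℕ → Set) → (∀ i → Dec (Q i)) → (d : ℕ) → Q d →
          Σ ℕ λ o → Q o × (∀ j → j < o → ¬ Q j)
  least Q Q? d q = search 0 d refl (λ j ())
    where
      -- invariant: Q fails below k, and the witness d lies at distance r above k
      search : (k r : ℕ) → k + r ≡ d → (∀ j → j < k → ¬ Q j) →
               Σ ℕ λ o → Q o × (∀ j → j < o → ¬ Q j)
      search k r k+r≡d below with Q? k
      ... | yes qk = k , qk , below
      search k zero    k+0≡d below | no ¬qk =
        ⊥-elim (¬qk (subst Q (sym (trans (sym (+-identityʳ k)) k+0≡d)) q))
      search k (suc r) k+r≡d below | no ¬qk =
        search (suc k) r (trans (sym (+-suc k r)) k+r≡d) below′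
        where
          below′ : ∀ j → j < suc k → ¬ Q j
          below′ j j<1+k qj with m≤n⇒m<n∨m≡n (s≤s⁻¹ j<1+k)
          ... | inj₁ j<k  = below j j<k qj
          ... | inj₂ refl = ¬qk qj

  prime-power-divisor : ∀ {p} → Prime p → ∀ k d → d ∣ p ^ k → Σ ℕ λ e → d ≡ p ^ e
  prime-power-divisor pp zero d d∣1 = 0 , ∣1⇒≡1 d∣1
  prime-power-divisor {p} pp (suc k) d d∣ with p ∣? d
  ... | no ¬p∣d = prime-power-divisor pp k d (coprime-divisor coprime d∣)
    where
      coprime : Coprime d p
      coprime (i∣d , i∣p) with prime⇒irreducible pp i∣p
      ... | inj₁ i≡1  = i≡1
      ... | inj₂ refl = ⊥-elim (¬p∣d i∣d)
  ... | yes (divides q refl)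
    with prime-power-divisor pp k q
           (*-cancelʳ-∣ p {{prime⇒nonZero pp}} (subst (q * p ∣_) (*-comm p (p ^ k)) d∣))
  ...   | e , q≡pᵉ = suc e , trans (cong (_* p) q≡pᵉ) (*-comm (p ^ e) p)

  prime-power-divisor-1-or-p : ∀ {p} → Prime p → ∀ k d → d ∣ p ^ k → d ≡ 1 ⊎ p ∣ d
  prime-power-divisor-1-or-p {p} pp k d d∣ with prime-power-divisor pp k d d∣
  ... | zero  , d≡1    = inj₁ d≡1
  ... | suc e , d≡pᵉ⁺¹ = inj₂ (divides (p ^ e) (trans d≡pᵉ⁺¹ (*-comm p (p ^ e))))

  odd-prime : ∀ {p} → Prime p → p ≢ 2 → p % 2 ≡ 1
  odd-prime {p} pp p≢2 with p % 2 in eq | m%n<n p 2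
  ... | 0 | _ with prime⇒irreducible pp (m%n≡0⇒n∣m p 2 eq)
  ...   | inj₁ ()
  ...   | inj₂ 2≡p = ⊥-elim (p≢2 (sym 2≡p))
  odd-prime pp p≢2 | 1 | _ = refl
  odd-prime pp p≢2 | suc (suc _) | s≤s (s≤s ())

  -- For odd p, 2 divides p ^ k + 1; this lets one halve exponents in a p-group.
  odd-power-plus-one : ∀ {p} → p % 2 ≡ 1 → ∀ k → 2 ∣ p ^ k + 1
  odd-power-plus-one {p} p%2≡1 k = m%n≡0⇒n∣m (p ^ k + 1) 2 (begin
    (p ^ k + 1) % 2           ≡⟨ %-distribˡ-+ (p ^ k) 1 2 ⟩
    (p ^ k % 2 + 1) % 2       ≡⟨ cong (λ r → (r + 1) % 2) (odd-pow k) ⟩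
    0                         ∎)
    where
      open ≡-Reasoning
      odd-pow : ∀ k → p ^ k % 2 ≡ 1
      odd-pow zero    = refl
      odd-pow (suc k) = begin
        (p * p ^ k) % 2           ≡⟨ %-distribˡ-* p (p ^ k) 2 ⟩
        (p % 2 * (p ^ k % 2)) % 2 ≡⟨ cong₂ (λ a b → (a * b) % 2) p%2≡1 (odd-pow k) ⟩
        1                         ∎

module Counting where

  open import Data.Nat hiding (_≟_)
  open import Data.Nat.Properties hiding (_≟_)
  open import Data.Nat.Solver using (module +-*-Solver)
  open import Data.List using (List; []; _∷_; length; filter; map; _++_)
  open import Data.List.Properties using (length-++; length-map; length-filter)
  open import Data.List.Membership.Propositional using (_∈_)
  open import Data.List.Membership.Propositional.Properties
  open import Data.List.Relation.Unary.Any using (here; there)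
  import Data.List.Relation.Unary.All as All
  open import Data.List.Relation.Unary.AllPairs using (_∷_; [])
  open import Data.List.Relation.Unary.Unique.Propositional using (Unique)
  import Data.List.Relation.Unary.Unique.Propositional.Properties as Unique
  open import Data.Product hiding (map)
  open import Data.Sum using (inj₁; inj₂)
  open import Data.Empty using (⊥-elim)
  open import Level using (0ℓ)
  open import Relation.Nullary
  open import Relation.Nullary.Decidable using (_×-dec_; decidable-stable)
  open import Relation.Unary using (Pred; Decidable)
  open import Relation.Binary.PropositionalEquality

  module _ {A : Set} where

    ⊆-length : (xs ys : List A) → Unique xs → (∀ {a} → a ∈ xs → a ∈ ys) →
               length xs ≤ length ys
    ⊆-length []       ys _           _   = z≤n
    ⊆-length (x ∷ xs) ys (x∉xs ∷ uxs) sub with ∈-∃++ (sub (here refl))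
    ... | us , vs , refl =
      ≤-trans (s≤s (⊆-length xs (us ++ vs) uxs sub′)) (≤-reflexive length-insert)
      where
        sub′ : ∀ {a} → a ∈ xs → a ∈ us ++ vs
        sub′ a∈xs with ∈-++⁻ us (sub (there a∈xs))
        ... | inj₁ a∈us         = ∈-++⁺ˡ a∈us
        ... | inj₂ (here refl)  = ⊥-elim (All.lookup x∉xs a∈xs refl)
        ... | inj₂ (there a∈vs) = ∈-++⁺ʳ us a∈vs
        length-insert : suc (length (us ++ vs)) ≡ length (us ++ x ∷ vs)
        length-insert rewrite length-++ us {vs} | length-++ us {x ∷ vs} =
          sym (+-suc (length us) (length vs))

    same-length : (xs ys : List A) → Unique xs → Unique ys →
      (∀ {a} → a ∈ xs → a ∈ ys) → (∀ {a} → a ∈ ys → a ∈ xs) → length xs ≡ length ys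
    same-length xs ys uxs uys xs⊆ys ys⊆xs =
      ≤-antisym (⊆-length xs ys uxs xs⊆ys) (⊆-length ys xs uys ys⊆xs)

    count : {P : Pred A 0ℓ} → Decidable P → List A → ℕ
    count P? xs = length (filter P? xs)

    count-≤ : {P : Pred A 0ℓ} (P? : Decidable P) (xs : List A) → count P? xs ≤ length xs
    count-≤ P? xs = length-filter P? xs

    count-list : {P : Pred A 0ℓ} (P? : Decidable P) (xs ys : List A) → Unique xs → Unique ys →
      (∀ {a} → a ∈ ys → a ∈ xs × P a) → (∀ {a} → a ∈ xs → P a → a ∈ ys) →
      count P? xs ≡ length ys
    count-list P? xs ys uxs uys ys⊆ xs⊆ =
      same-length (filter P? xs) ys (Unique.filter⁺ P? uxs) uys
        (λ a∈ → let (a∈xs , pa) = ∈-filter⁻ P? a∈ in xs⊆ a∈xs pa)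
        (λ a∈ → let (a∈xs , pa) = ys⊆ a∈ in ∈-filter⁺ P? a∈xs pa)

    count-ext : {P Q : Pred A 0ℓ} (P? : Decidable P) (Q? : Decidable Q) (xs : List A) →
      (∀ a → P a → Q a) → (∀ a → Q a → P a) → count P? xs ≡ count Q? xs
    count-ext P? Q? []       P⇒Q Q⇒P = refl
    count-ext P? Q? (x ∷ xs) P⇒Q Q⇒P with P? x | Q? x
    ... | yes _  | yes _  = cong suc (count-ext P? Q? xs P⇒Q Q⇒P)
    ... | no _   | no _   = count-ext P? Q? xs P⇒Q Q⇒P
    ... | yes px | no ¬qx = ⊥-elim (¬qx (P⇒Q x px))
    ... | no ¬px | yes qx = ⊥-elim (¬px (Q⇒P x qx))

    count-mono : {P Q : Pred A 0ℓ} (P? : Decidable P) (Q? : Decidable Q) (xs : List A) →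
      (∀ a → P a → Q a) → count P? xs ≤ count Q? xs
    count-mono P? Q? []       P⇒Q = z≤n
    count-mono P? Q? (x ∷ xs) P⇒Q with P? x | Q? x
    ... | yes _  | yes _  = s≤s (count-mono P? Q? xs P⇒Q)
    ... | no _   | no _   = count-mono P? Q? xs P⇒Q
    ... | yes px | no ¬qx = ⊥-elim (¬qx (P⇒Q x px))
    ... | no _   | yes _  = m≤n⇒m≤1+n (count-mono P? Q? xs P⇒Q)

    count-strict : {P Q : Pred A 0ℓ} (P? : Decidable P) (Q? : Decidable Q) (xs : List A) →
      (∀ a → P a → Q a) → (a : A) → a ∈ xs → Q a → ¬ P a → count P? xs < count Q? xs
    count-strict P? Q? (x ∷ xs) P⇒Q a (here refl) qa ¬pa with P? x | Q? x
    ... | yes pa | _      = ⊥-elim (¬pa pa)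
    ... | no _   | yes _  = s≤s (count-mono P? Q? xs P⇒Q)
    ... | no _   | no ¬qa = ⊥-elim (¬qa qa)
    count-strict P? Q? (x ∷ xs) P⇒Q a (there a∈) qa ¬pa with P? x | Q? x
    ... | yes _  | yes _  = s≤s (count-strict P? Q? xs P⇒Q a a∈ qa ¬pa)
    ... | no _   | no _   = count-strict P? Q? xs P⇒Q a a∈ qa ¬pa
    ... | yes px | no ¬qx = ⊥-elim (¬qx (P⇒Q x px))
    ... | no _   | yes _  = m≤n⇒m≤1+n (count-strict P? Q? xs P⇒Q a a∈ qa ¬pa)

    count-filter : {Q R : Pred A 0ℓ} (Q? : Decidable Q) (R? : Decidable R) (xs : List A) →
      (∀ a → Q a → R a) → count Q? (filter R? xs) ≡ count Q? xs
    count-filter Q? R? []       Q⇒R = refl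
    count-filter Q? R? (x ∷ xs) Q⇒R with R? x
    ... | yes _ with Q? x
    ...   | yes _ = cong suc (count-filter Q? R? xs Q⇒R)
    ...   | no _  = count-filter Q? R? xs Q⇒R
    count-filter Q? R? (x ∷ xs) Q⇒R | no ¬rx with Q? x
    ...   | yes qx = ⊥-elim (¬rx (Q⇒R x qx))
    ...   | no _   = count-filter Q? R? xs Q⇒R

    count-split : {P : Pred A 0ℓ} (P? : Decidable P) (xs : List A) →
      length xs ≡ count P? xs + count (λ a → ¬? (P? a)) xs
    count-split P? []       = refl
    count-split P? (x ∷ xs) with P? x
    ... | yes _ = cong suc (count-split P? xs)
    ... | no _  = trans (cong suc (count-split P? xs)) (sym (+-suc _ _))

    count-split-by : {P Q : Pred A 0ℓ} (P? : Decidable P) (Q? : Decidable Q) (xs : List A) →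
      count P? xs ≡ count (λ a → P? a ×-dec Q? a) xs + count (λ a → P? a ×-dec ¬? (Q? a)) xs
    count-split-by P? Q? []       = refl
    count-split-by P? Q? (x ∷ xs) with P? x | Q? x
    ... | yes _ | yes _ = cong suc (count-split-by P? Q? xs)
    ... | yes _ | no _  = trans (cong suc (count-split-by P? Q? xs)) (sym (+-suc _ _))
    ... | no _  | yes _ = count-split-by P? Q? xs
    ... | no _  | no _  = count-split-by P? Q? xs

    count-one : {P : Pred A 0ℓ} (P? : Decidable P) (xs : List A) (a : A) →
      a ∈ xs → P a → 1 ≤ count P? xs
    count-one P? (x ∷ xs) a a∈ pa with P? x
    ... | yes _ = s≤s z≤n
    count-one P? (x ∷ xs) a (here refl) pa | no ¬pa = ⊥-elim (¬pa pa)
    count-one P? (x ∷ xs) a (there a∈)  pa | no _   = count-one P? xs a a∈ pa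

    count-two : {P : Pred A 0ℓ} (P? : Decidable P) (xs : List A) → Unique xs →
      (a b : A) → a ≢ b → a ∈ xs → b ∈ xs → P a → P b → 2 ≤ count P? xs
    count-two P? xs uxs a b a≢b a∈ b∈ pa pb =
      ⊆-length (a ∷ b ∷ []) (filter P? xs) ((a≢b All.∷ All.[]) ∷ (All.[] ∷ []))
        λ { (here refl)         → ∈-filter⁺ P? a∈ pa
          ; (there (here refl)) → ∈-filter⁺ P? b∈ pb }

    count-1-unique : ((a b : A) → Dec (a ≡ b)) → {P : Pred A 0ℓ} (P? : Decidable P)
      (xs : List A) → Unique xs → count P? xs ≡ 1 →
      (a b : A) → a ∈ xs → b ∈ xs → P a → P b → a ≡ b
    count-1-unique _≟_ P? xs uxs c≡1 a b a∈ b∈ pa pb =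
      decidable-stable (a ≟ b) λ a≢b →
        1+n≰n (subst (2 ≤_) c≡1 (count-two P? xs uxs a b a≢b a∈ b∈ pa pb))

    count-bij : {P Q : Pred A 0ℓ} (P? : Decidable P) (Q? : Decidable Q) (φ ψ : A → A) →
      (∀ a → ψ (φ a) ≡ a) → (∀ a → φ (ψ a) ≡ a) →
      (∀ a → Q a → P (φ a)) → (∀ a → P (φ a) → Q a) →
      (xs : List A) → Unique xs → (∀ a → a ∈ xs) → count Q? xs ≡ count P? xs
    count-bij {P} {Q} P? Q? φ ψ ψφ φψ Q⇒Pφ Pφ⇒Q xs uxs all∈ =
      trans (sym (length-map φ (filter Q? xs)))
        (sym (count-list P? xs (map φ (filter Q? xs)) uxs
          (Unique.map⁺ φ-injective (Unique.filter⁺ Q? {xs} uxs)) image⊆ ⊆image))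
      where
        φ-injective : ∀ {a b} → φ a ≡ φ b → a ≡ b
        φ-injective {a} {b} e = trans (sym (ψφ a)) (trans (cong ψ e) (ψφ b))
        image⊆ : ∀ {a} → a ∈ map φ (filter Q? xs) → a ∈ xs × P a
        image⊆ a∈ with ∈-map⁻ φ a∈
        ... | b , b∈ , refl = all∈ _ , Q⇒Pφ b (proj₂ (∈-filter⁻ Q? {xs = xs} b∈))
        ⊆image : ∀ {a} → a ∈ xs → P a → a ∈ map φ (filter Q? xs)
        ⊆image {a} _ pa = subst (_∈ map φ (filter Q? xs)) (φψ a)
          (∈-map⁺ φ (∈-filter⁺ Q? (all∈ (ψ a)) (Pφ⇒Q (ψ a) (subst P (sym (φψ a)) pa))))

  sumOver : {B : Set} → List B → (B → ℕ) → ℕ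
  sumOver []       f = 0
  sumOver (b ∷ bs) f = f b + sumOver bs f

  indicator : {P : Set} → Dec P → ℕ
  indicator (yes _) = 1
  indicator (no _)  = 0

  module _ {B : Set} where

    sumOver-cong : (O : List B) (f g : B → ℕ) → (∀ {s} → s ∈ O → f s ≡ g s) →
      sumOver O f ≡ sumOver O g
    sumOver-cong []      f g f≡g = refl
    sumOver-cong (b ∷ O) f g f≡g =
      cong₂ _+_ (f≡g (here refl)) (sumOver-cong O f g (λ s∈ → f≡g (there s∈)))

    sumOver-const : (O : List B) (f : B → ℕ) (c : ℕ) → (∀ {s} → s ∈ O → f s ≡ c) →
      sumOver O f ≡ length O * c
    sumOver-const O f c f≡c = trans (sumOver-cong O f (λ _ → c) f≡c) (const-sum O)
      where
        const-sum : ∀ O → sumOver O (λ _ → c) ≡ length O * c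
        const-sum []      = refl
        const-sum (_ ∷ O) = cong (c +_) (const-sum O)

    sumOver-indicator : {Q : Pred B 0ℓ} (Q? : Decidable Q) (O : List B) →
      sumOver O (λ c → indicator (Q? c)) ≡ count Q? O
    sumOver-indicator Q? []      = refl
    sumOver-indicator Q? (b ∷ O) with Q? b
    ... | yes _ = cong suc (sumOver-indicator Q? O)
    ... | no _  = sumOver-indicator Q? O

    sumOver-mod : (p : ℕ) (O : List B) (f g : B → ℕ) →
      (∀ {s} → s ∈ O → ∃ λ t → f s ≡ g s + p * t) → ∃ λ t → sumOver O f ≡ sumOver O g + p * t
    sumOver-mod p []      f g f≡g = 0 , sym (*-zeroʳ p)
    sumOver-mod p (b ∷ O) f g f≡g
      with f≡g (here refl) | sumOver-mod p O f g (λ s∈ → f≡g (there s∈))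
    ... | t₁ , e₁ | t₂ , e₂ = t₁ + t₂ , (begin
      f b + sumOver O f                        ≡⟨ cong₂ _+_ e₁ e₂ ⟩
      (g b + p * t₁) + (sumOver O g + p * t₂)  ≡⟨ +-*-Solver.solve 5
          (λ a b c d p → (a :+ p :* b) :+ (c :+ p :* d) := (a :+ c) :+ p :* (b :+ d))
          refl (g b) t₁ (sumOver O g) t₂ p ⟩
      (g b + sumOver O g) + p * (t₁ + t₂)      ∎)
      where
        open ≡-Reasoning
        open +-*-Solver

  module _ {A B : Set} (_≟B_ : (a b : B) → Dec (a ≡ b)) (F : A → B) where

    fiber-sum : (xs : List A) (O : List B) → Unique O → (∀ {a} → a ∈ xs → F a ∈ O) →
      length xs ≡ sumOver O (λ s → count (λ a → F a ≟B s) xs)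
    fiber-sum [] O _ _ = sym (trans (sumOver-const O _ 0 (λ _ → refl)) (*-zeroʳ (length O)))
    fiber-sum (a ∷ xs) [] _ F∈ with F∈ (here refl)
    ... | ()
    fiber-sum xs (s ∷ O) (s∉O ∷ uO) F∈ =
      trans (count-split (λ a → F a ≟B s) xs)
        (cong (count (λ a → F a ≟B s) xs +_)
          (trans (fiber-sum rest O uO F∈O)
            (sumOver-cong O _ _ λ {s′} s′∈O →
              count-filter (λ a → F a ≟B s′) (λ a → ¬? (F a ≟B s)) xs
                (λ a Fa≡s′ Fa≡s → All.lookup s∉O s′∈O (trans (sym Fa≡s) Fa≡s′)))))
      where
        rest : List A
        rest = filter (λ a → ¬? (F a ≟B s)) xs
        F∈O : ∀ {a} → a ∈ rest → F a ∈ O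
        F∈O a∈ with ∈-filter⁻ (λ a → ¬? (F a ≟B s)) a∈
        ... | a∈xs , Fa≢s with F∈ a∈xs
        ... | here Fa≡s = ⊥-elim (Fa≢s Fa≡s)
        ... | there Fa∈O = Fa∈O

-- Without quotient types, a quotient of a finite type A by a decidable
-- equivalence R is modelled by canonical representatives: rep a is the first
-- element of a fixed enumeration L that is R-related to a.  The classes then
-- partition L, which gives the counting formula |A| = Σ_c |class c|.
module Representatives {A : Set} (_≟_ : (a b : A) → Dec (a ≡ b))
  (L : List A) (L-unique : Unique L) (L-complete : ∀ a → a ∈ L)
  (R : A → A → Set) (R? : ∀ a b → Dec (R a b))
  (R-refl : ∀ a → R a a) (R-sym : ∀ {a b} → R a b → R b a)
  (R-trans : ∀ {a b c} → R a b → R b c → R a c) where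
  open import Data.List using (List; []; _∷_; length; filter)
  open import Data.List.Membership.Propositional using (_∈_)
  open import Data.List.Membership.Propositional.Properties using (∈-filter⁺; ∈-filter⁻)
  open import Data.List.Relation.Unary.Any using (here; there)
  open import Data.List.Relation.Unary.Unique.Propositional using (Unique)
  import Data.List.Relation.Unary.Unique.Propositional.Properties as Unique
  open import Data.Product using (proj₂)
  open import Data.Empty using (⊥-elim)
  open import Relation.Nullary using (Dec; yes; no)
  open import Relation.Binary.PropositionalEquality
  open Counting

  first : A → A → List A → A
  first d a []       = d
  first d a (b ∷ bs) with R? a b
  ... | yes _ = b
  ... | no _  = first d a bs

  first-class : ∀ d a c bs → (∀ b → R a b → R c b) → (∀ b → R c b → R a b) →
    first d a bs ≡ first d c bs
  first-class d a c []       _   _   = refl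
  first-class d a c (b ∷ bs) a⇒c c⇒a with R? a b | R? c b
  ... | yes _  | yes _  = refl
  ... | no _   | no _   = first-class d a c bs a⇒c c⇒a
  ... | yes ab | no ¬cb = ⊥-elim (¬cb (a⇒c b ab))
  ... | no ¬ab | yes cb = ⊥-elim (¬ab (c⇒a b cb))

  first-default : ∀ d d′ a bs b → b ∈ bs → R a b → first d a bs ≡ first d′ a bs
  first-default d d′ a (x ∷ bs) b b∈ ab with R? a x
  ... | yes _ = refl
  first-default d d′ a (x ∷ bs) b (here refl) ab | no ¬ax = ⊥-elim (¬ax ab)
  first-default d d′ a (x ∷ bs) b (there b∈)  ab | no _   = first-default d d′ a bs b b∈ ab

  first-related : ∀ d a bs b → b ∈ bs → R a b → R a (first d a bs)
  first-related d a (x ∷ bs) b b∈ ab with R? a x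
  ... | yes ax = ax
  first-related d a (x ∷ bs) b (here refl) ab | no ¬ax = ⊥-elim (¬ax ab)
  first-related d a (x ∷ bs) b (there b∈)  ab | no _   = first-related d a bs b b∈ ab

  rep : A → A
  rep a = first a a L

  rep-R : ∀ a → R a (rep a)
  rep-R a = first-related a a L a (L-complete a) (R-refl a)

  rep-eq : ∀ {a c} → R a c → rep a ≡ rep c
  rep-eq {a} {c} ac =
    trans (first-class a a c L (λ b ab → R-trans (R-sym ac) ab) (λ b cb → R-trans ac cb))
          (first-default a c c L c (L-complete c) (R-refl c))

  Canonical : A → Set
  Canonical a = rep a ≡ a

  Canonical? : ∀ a → Dec (Canonical a)
  Canonical? a = rep a ≟ a

  rep-canonical : ∀ a → Canonical (rep a)
  rep-canonical a = sym (rep-eq (rep-R a))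

  rep≡⇒R : ∀ {a c} → rep a ≡ c → R c a
  rep≡⇒R {a} refl = R-sym (rep-R a)

  R⇒rep≡ : ∀ {a c} → Canonical c → R c a → rep a ≡ c
  R⇒rep≡ cc ca = trans (sym (rep-eq ca)) cc

  Reps : List A
  Reps = filter Canonical? L

  class-sum : length L ≡ sumOver Reps (λ c → count (R? c) L)
  class-sum = trans
    (fiber-sum _≟_ rep L Reps (Unique.filter⁺ Canonical? L-unique)
       (λ {a} _ → ∈-filter⁺ Canonical? (L-complete (rep a)) (rep-canonical a)))
    (sumOver-cong Reps _ _ λ {c} c∈ →
       count-ext (λ a → rep a ≟ c) (R? c) L (λ a → rep≡⇒R)
         (λ a → R⇒rep≡ (proj₂ (∈-filter⁻ Canonical? {xs = L} c∈))))

module GroupFacts (H : Grp) where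
  open import Level using (0ℓ)
  open import Data.Nat using (ℕ; zero; suc; _+_; _*_; NonZero; >-nonZero)
  open import Data.Nat.Properties using (*-comm; +-comm; n≢0⇒n>0; _≟_)
  open import Data.Nat.DivMod using (_%_; _/_; m≡m%n+[m/n]*n; m%n<n)
  open import Data.Nat.Divisibility using (_∣_; m%n≡0⇒n∣m)
  open import Relation.Nullary.Decidable using (decidable-stable)
  open import Data.Product using (_,_)
  open import Data.List using ([]; _∷_)
  open import Data.Bool using (false)
  open import Relation.Binary.PropositionalEquality
  open import Algebra.Bundles using (Group; Monoid)
  import Algebra.Properties.Group as GroupProperties
  import Algebra.Properties.Monoid.Mult as MonoidMult
  import Algebra.Solver.Monoid as MonoidSolver
  open Grp H public

  group : Group 0ℓ 0ℓ
  group = record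
    { Carrier = Carrier ; _≈_ = _≡_ ; _∙_ = _∙_ ; ε = ε ; _⁻¹ = _⁻¹
    ; isGroup = record
      { isMonoid = record
        { isSemigroup = record
          { isMagma = record { isEquivalence = isEquivalence ; ∙-cong = cong₂ _∙_ }
          ; assoc = assoc }
        ; identity = identityˡ , identityʳ }
      ; inverse = inverseˡ , inverseʳ
      ; ⁻¹-cong = cong _⁻¹ } }

  open Group group using (monoid)
  open GroupProperties group public
    using (⁻¹-involutive; ⁻¹-anti-homo-∙; inverseʳ-unique; ∙-cancelˡ)
    renaming (ε⁻¹≈ε to ε⁻¹≡ε; \\-leftDividesʳ to ⁻¹-cancelˡ; \\-leftDividesˡ to cancelˡ-⁻¹)

  trivial-normal : IsNormalSubgroup raw (_≡ ε)
  trivial-normal = refl , (λ { _ _ refl refl → identityˡ ε }) , (λ { _ refl → ε⁻¹≡ε })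
                 , (λ { g _ refl → trans (cong (_∙ g ⁻¹) (identityʳ g)) (inverseʳ g) })

  module ∙-Solver = MonoidSolver monoid

  pw : Carrier → ℕ → Carrier
  pw = pow raw

  -- pow agrees with the library's monoid multiples, whose laws we reuse
  open MonoidMult monoid using (×-homo-+; ×-assocˡ) renaming (_×_ to _×ᴹ_)

  pw≡× : ∀ a n → pw a n ≡ n ×ᴹ a
  pw≡× a zero    = refl
  pw≡× a (suc n) = cong (a ∙_) (pw≡× a n)

  pow-add : ∀ a m n → pw a (m + n) ≡ pw a m ∙ pw a n
  pow-add a m n rewrite pw≡× a (m + n) | pw≡× a m | pw≡× a n = ×-homo-+ a m n

  pow-mul : ∀ a m n → pw a (m * n) ≡ pw (pw a m) n
  pow-mul a m n rewrite pw≡× a (m * n) | pw≡× (pw a m) n | pw≡× a m =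
    trans (cong (_×ᴹ a) (*-comm m n)) (sym (×-assocˡ a n m))

  pow-ε : ∀ n → pw ε n ≡ ε
  pow-ε zero    = refl
  pow-ε (suc n) = trans (identityˡ _) (pow-ε n)

  pow-inv : ∀ a n → pw (a ⁻¹) n ≡ (pw a n) ⁻¹
  pow-inv a zero    = sym ε⁻¹≡ε
  pow-inv a (suc n) = begin
    a ⁻¹ ∙ pw (a ⁻¹) n        ≡⟨ cong (a ⁻¹ ∙_) (pow-inv a n) ⟩
    a ⁻¹ ∙ (pw a n) ⁻¹        ≡⟨ sym (⁻¹-anti-homo-∙ (pw a n) a) ⟩
    (pw a n ∙ a) ⁻¹           ≡⟨ cong _⁻¹ (sym (trans (pow-add a n 1) (cong (pw a n ∙_) (identityʳ a)))) ⟩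
    (pw a (n + 1)) ⁻¹         ≡⟨ cong (λ m → (pw a m) ⁻¹) (+-comm n 1) ⟩
    (a ∙ pw a n) ⁻¹           ∎
    where open ≡-Reasoning

  pow-multiple : ∀ a n → pw a n ≡ ε → ∀ q → pw a (q * n) ≡ ε
  pow-multiple a n aⁿ≡ε q =
    trans (cong (pw a) (*-comm q n)) (trans (pow-mul a n q) (trans (cong (λ b → pw b q) aⁿ≡ε) (pow-ε q)))

  module Homomorphism (f : Carrier → Carrier) (f-∙ : ∀ a b → f (a ∙ b) ≡ f a ∙ f b) where
    f-ε : f ε ≡ ε
    f-ε = ∙-cancelˡ (f ε) (f ε) ε
      (trans (sym (f-∙ ε ε)) (trans (cong f (identityˡ ε)) (sym (identityʳ _))))

    f-⁻¹ : ∀ a → f (a ⁻¹) ≡ f a ⁻¹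
    f-⁻¹ a = inverseʳ-unique (f a) (f (a ⁻¹)) (trans (sym (f-∙ a (a ⁻¹))) (trans (cong f (inverseʳ a)) f-ε))

    f-pow : ∀ a n → f (pw a n) ≡ pw (f a) n
    f-pow a zero    = f-ε
    f-pow a (suc n) = trans (f-∙ a (pw a n)) (cong (f a ∙_) (f-pow a n))

  semidirect-pow : ∀ τ g j → pow (Semidirect H τ) (g , false) j ≡ (pw g j , false)
  semidirect-pow τ g zero    = refl
  semidirect-pow τ g (suc j) = cong (RawGrp._∙_ (Semidirect H τ) (g , false)) (semidirect-pow τ g j)

  order-divides : ∀ {x o} N → IsOrder H x o → pw x N ≡ ε → o ∣ N
  order-divides {x} {o} N (0<o , xᵒ≡ε , minimal) xᴺ≡ε =
    m%n≡0⇒n∣m N o (decidable-stable (N % o ≟ 0) λ r≢0 → minimal (N % o) (n≢0⇒n>0 r≢0) (m%n<n N o) xʳ≡ε)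
    where
      instance
        o-nonZero : NonZero o
        o-nonZero = >-nonZero 0<o
      xʳ≡ε : pw x (N % o) ≡ ε
      xʳ≡ε = begin
        pw x (N % o)                            ≡⟨ identityʳ _ ⟨
        pw x (N % o) ∙ ε                        ≡⟨ cong (pw x (N % o) ∙_) (pow-multiple x o xᵒ≡ε (N / o)) ⟨
        pw x (N % o) ∙ pw x ((N / o) * o)       ≡⟨ pow-add x (N % o) _ ⟨
        pw x (N % o + (N / o) * o)              ≡⟨ cong (pw x) (m≡m%n+[m/n]*n N o) ⟨
        pw x N                                  ≡⟨ xᴺ≡ε ⟩
        ε                                       ∎
        where open ≡-Reasoning

  endomorphisms-agree : (x y : Carrier) → Generates H x y →
    (f g : Carrier → Carrier) → (∀ a b → f (a ∙ b) ≡ f a ∙ f b) → (∀ a b → g (a ∙ b) ≡ g a ∙ g b) →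
    f x ≡ g x → f y ≡ g y → ∀ a → f a ≡ g a
  endomorphisms-agree x y generates f g f-∙ g-∙ fx≡gx fy≡gy a =
    let (w , w≡a) = generates a in subst (λ b → f b ≡ g b) w≡a (on-words w)
    where
      open Homomorphism f f-∙ using (f-ε) renaming (f-⁻¹ to f-inv)
      open Homomorphism g g-∙ using () renaming (f-ε to g-ε; f-⁻¹ to g-inv)
      step : ∀ {u v} → f u ≡ g u → f v ≡ g v → f (u ∙ v) ≡ g (u ∙ v)
      step {u} {v} fu≡gu fv≡gv = trans (f-∙ u v) (trans (cong₂ _∙_ fu≡gu fv≡gv) (sym (g-∙ u v)))
      step⁻¹ : ∀ {u} → f u ≡ g u → f (u ⁻¹) ≡ g (u ⁻¹)
      step⁻¹ {u} fu≡gu = trans (f-inv u) (trans (cong _⁻¹ fu≡gu) (sym (g-inv u)))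
      on-words : ∀ w → f (evalWord H x y w) ≡ g (evalWord H x y w)
      on-words []        = trans f-ε (sym g-ε)
      on-words (X ∷ w)   = step fx≡gx (on-words w)
      on-words (Y ∷ w)   = step fy≡gy (on-words w)
      on-words (X⁻ ∷ w)  = step (step⁻¹ fx≡gx) (on-words w)
      on-words (Y⁻ ∷ w)  = step (step⁻¹ fy≡gy) (on-words w)

-- Since there
-- are no quotient types, H/M is handled through the relation a ≈ b ⇔ a⁻¹b ∈ M,
-- which is a congruence for the group operations.
module NormalSubgroups (H : Grp) where
  open import Level using (0ℓ)
  open import Data.Nat using (zero; suc)
  open import Relation.Unary using (Decidable)
  open import Relation.Binary.Bundles using (Setoid)
  open import Relation.Binary.PropositionalEquality
  import Relation.Binary.Reasoning.Setoid as SetoidReasoning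

  open GroupFacts H

  record NormalSubgroup : Set₁ where
    field
      In     : Carrier → Set
      In?    : Decidable In
      In-ε   : In ε
      In-∙   : ∀ a b → In a → In b → In (a ∙ b)
      In-⁻¹  : ∀ a → In a → In (a ⁻¹)
      In-conj : ∀ g a → In a → In ((g ∙ a) ∙ g ⁻¹)

  module Modulo (M : NormalSubgroup) where
    open NormalSubgroup M

    infix 4 _≈_
    _≈_ : Carrier → Carrier → Set
    a ≈ b = In (a ⁻¹ ∙ b)

    ≈-refl : ∀ a → a ≈ a
    ≈-refl a = subst In (sym (inverseˡ a)) In-ε

    ≈-reflexive : ∀ {a b} → a ≡ b → a ≈ b
    ≈-reflexive {a} refl = ≈-refl a

    ≈-sym : ∀ {a b} → a ≈ b → b ≈ a
    ≈-sym {a} {b} a≈b =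
      subst In (trans (⁻¹-anti-homo-∙ (a ⁻¹) b) (cong (b ⁻¹ ∙_) (⁻¹-involutive a))) (In-⁻¹ _ a≈b)

    ≈-trans : ∀ {a b c} → a ≈ b → b ≈ c → a ≈ c
    ≈-trans {a} {b} {c} a≈b b≈c =
      subst In (trans (assoc _ _ _) (cong (a ⁻¹ ∙_) (cancelˡ-⁻¹ b c))) (In-∙ _ _ a≈b b≈c)

    ≈-setoid : Setoid 0ℓ 0ℓ
    ≈-setoid = record
      { Carrier = Carrier ; _≈_ = _≈_
      ; isEquivalence = record { refl = ≈-refl _ ; sym = ≈-sym ; trans = ≈-trans } }

    module ≈-Reasoning = SetoidReasoning ≈-setoid

    In⇒ε≈ : ∀ {a} → In a → ε ≈ a
    In⇒ε≈ {a} = subst In (sym (trans (cong (_∙ a) ε⁻¹≡ε) (identityˡ a)))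

    ε≈⇒In : ∀ {a} → ε ≈ a → In a
    ε≈⇒In {a} = subst In (trans (cong (_∙ a) ε⁻¹≡ε) (identityˡ a))

    In⇒≈ε : ∀ {a} → In a → a ≈ ε
    In⇒≈ε a∈M = ≈-sym (In⇒ε≈ a∈M)

    In-resp : ∀ {a b} → a ≈ b → In a → In b
    In-resp a≈b a∈M = ε≈⇒In (≈-trans (In⇒ε≈ a∈M) a≈b)

    In-conj⁻¹ : ∀ g a → In a → In (g ⁻¹ ∙ (a ∙ g))
    In-conj⁻¹ g a a∈M =
      subst In (trans (assoc _ _ _) (cong (λ h → g ⁻¹ ∙ (a ∙ h)) (⁻¹-involutive g))) (In-conj (g ⁻¹) a a∈M)

    ∙-congˡ : ∀ c {a b} → a ≈ b → c ∙ a ≈ c ∙ b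
    ∙-congˡ c {a} {b} = subst In (sym (begin
      (c ∙ a) ⁻¹ ∙ (c ∙ b)       ≡⟨ cong (_∙ (c ∙ b)) (⁻¹-anti-homo-∙ c a) ⟩
      (a ⁻¹ ∙ c ⁻¹) ∙ (c ∙ b)    ≡⟨ assoc _ _ _ ⟩
      a ⁻¹ ∙ (c ⁻¹ ∙ (c ∙ b))    ≡⟨ cong (a ⁻¹ ∙_) (⁻¹-cancelˡ c b) ⟩
      a ⁻¹ ∙ b                   ∎))
      where open ≡-Reasoning

    -- right multiplication needs normality of M
    ∙-congʳ : ∀ {a b} c → a ≈ b → a ∙ c ≈ b ∙ c
    ∙-congʳ {a} {b} c a≈b = subst In (begin
      c ⁻¹ ∙ ((a ⁻¹ ∙ b) ∙ c)    ≡⟨ cong (c ⁻¹ ∙_) (assoc _ _ _) ⟩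
      c ⁻¹ ∙ (a ⁻¹ ∙ (b ∙ c))    ≡⟨ sym (assoc _ _ _) ⟩
      (c ⁻¹ ∙ a ⁻¹) ∙ (b ∙ c)    ≡⟨ cong (_∙ (b ∙ c)) (sym (⁻¹-anti-homo-∙ a c)) ⟩
      (a ∙ c) ⁻¹ ∙ (b ∙ c)       ∎) (In-conj⁻¹ c _ a≈b)
      where open ≡-Reasoning

    ∙-cong : ∀ {a b c d} → a ≈ b → c ≈ d → a ∙ c ≈ b ∙ d
    ∙-cong {a} {b} {c} a≈b c≈d = ≈-trans (∙-congʳ c a≈b) (∙-congˡ b c≈d)

    ⁻¹-unique : ∀ {x y} → x ∙ y ≈ ε → x ⁻¹ ≈ y
    ⁻¹-unique {x} {y} xy≈ε = begin
      x ⁻¹               ≡⟨ identityʳ _ ⟨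
      x ⁻¹ ∙ ε           ≈⟨ ∙-congˡ (x ⁻¹) xy≈ε ⟨
      x ⁻¹ ∙ (x ∙ y)     ≡⟨ ⁻¹-cancelˡ x y ⟩
      y                  ∎
      where open ≈-Reasoning

    ⁻¹-cong : ∀ {a b} → a ≈ b → a ⁻¹ ≈ b ⁻¹
    ⁻¹-cong {a} {b} a≈b = ⁻¹-unique (begin
      a ∙ b ⁻¹           ≈⟨ ∙-congʳ (b ⁻¹) a≈b ⟩
      b ∙ b ⁻¹           ≡⟨ inverseʳ b ⟩
      ε                  ∎)
      where open ≈-Reasoning

    pow-cong : ∀ {a b} n → a ≈ b → pw a n ≈ pw b n
    pow-cong zero    a≈b = ≈-refl ε
    pow-cong (suc n) a≈b = ∙-cong a≈b (pow-cong n a≈b)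

    pow-≈ε : ∀ {a} n → a ≈ ε → pw a n ≈ ε
    pow-≈ε n a≈ε = ≈-trans (pow-cong n a≈ε) (≈-reflexive (pow-ε n))

    -- g is central modulo M, i.e. g M lies in the centre of H/M
    Central : Carrier → Set
    Central g = ∀ h → h ∙ g ≈ g ∙ h

    Central-resp : ∀ {a b} → a ≈ b → Central a → Central b
    Central-resp {a} {b} a≈b a-central h = begin
      h ∙ b    ≈⟨ ∙-congˡ h a≈b ⟨
      h ∙ a    ≈⟨ a-central h ⟩
      a ∙ h    ≈⟨ ∙-congʳ h a≈b ⟩
      b ∙ h    ∎
      where open ≈-Reasoning

    Central-ε : Central ε
    Central-ε h = ≈-reflexive (trans (identityʳ h) (sym (identityˡ h)))

    Central-∙ : ∀ {a b} → Central a → Central b → Central (a ∙ b)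
    Central-∙ {a} {b} a-central b-central h = begin
      h ∙ (a ∙ b)     ≡⟨ assoc h a b ⟨
      (h ∙ a) ∙ b     ≈⟨ ∙-congʳ b (a-central h) ⟩
      (a ∙ h) ∙ b     ≡⟨ assoc a h b ⟩
      a ∙ (h ∙ b)     ≈⟨ ∙-congˡ a (b-central h) ⟩
      a ∙ (b ∙ h)     ≡⟨ assoc a b h ⟨
      (a ∙ b) ∙ h     ∎
      where open ≈-Reasoning

    Central-pow : ∀ {a} n → Central a → Central (pw a n)
    Central-pow zero    _         = Central-ε
    Central-pow (suc n) a-central = Central-∙ a-central (Central-pow n a-central)

    pow-∙ : ∀ {a} b n → Central a → pw (a ∙ b) n ≈ pw a n ∙ pw b n
    pow-∙ {a} b zero    _         = ≈-reflexive (sym (identityˡ ε))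
    pow-∙ {a} b (suc n) a-central = begin
      (a ∙ b) ∙ pw (a ∙ b) n          ≈⟨ ∙-congˡ (a ∙ b) (pow-∙ b n a-central) ⟩
      (a ∙ b) ∙ (pw a n ∙ pw b n)     ≡⟨ ∙-Solver.solve 4 (λ a b x y → (a ⊕ b) ⊕ (x ⊕ y) ⊜ a ⊕ ((b ⊕ x) ⊕ y))
                                           refl a b (pw a n) (pw b n) ⟩
      a ∙ ((b ∙ pw a n) ∙ pw b n)     ≈⟨ ∙-congˡ a (∙-congʳ (pw b n) (Central-pow n a-central b)) ⟩
      a ∙ ((pw a n ∙ b) ∙ pw b n)     ≡⟨ ∙-Solver.solve 4 (λ a x b y → a ⊕ ((x ⊕ b) ⊕ y) ⊜ (a ⊕ x) ⊕ (b ⊕ y))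
                                           refl a (pw a n) b (pw b n) ⟩
      (a ∙ pw a n) ∙ (b ∙ pw b n)     ∎
      where open ≈-Reasoning
            open ∙-Solver using (_⊕_; _⊜_)

    module Involution (τ : Carrier → Carrier) (τ-∙ : ∀ a b → τ (a ∙ b) ≡ τ a ∙ τ b)
                      (τ-τ : ∀ a → τ (τ a) ≡ a) (τ-In : ∀ a → In a → In (τ a)) where
      open Homomorphism τ τ-∙

      τ-≈ : ∀ {a b} → a ≈ b → τ a ≈ τ b
      τ-≈ {a} {b} a≈b = subst In (trans (τ-∙ _ _) (cong (_∙ τ b) (f-⁻¹ a))) (τ-In _ a≈b)

      Central-τ : ∀ {a} → Central a → Central (τ a)
      Central-τ {a} a-central h = begin
        h ∙ τ a             ≡⟨ cong (_∙ τ a) (τ-τ h) ⟨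
        τ (τ h) ∙ τ a       ≡⟨ τ-∙ (τ h) a ⟨
        τ (τ h ∙ a)         ≈⟨ τ-≈ (a-central (τ h)) ⟩
        τ (a ∙ τ h)         ≡⟨ τ-∙ a (τ h) ⟩
        τ a ∙ τ (τ h)       ≡⟨ cong (τ a ∙_) (τ-τ h) ⟩
        τ a ∙ h             ∎
        where open ≈-Reasoning

module FiniteGroups (H : Grp) (n : ℕ) (enum : Grp.Carrier H ↔ Fin n) where
  open Counting
  open Arithmetic
  open import Data.Nat hiding (_≟_)
  open import Data.Nat.Properties hiding (_≟_)
  open import Data.Nat.DivMod
  open import Data.Nat.Primality using (Prime)
  open import Data.Nat.Divisibility using (divides)
  open import Data.Fin using (Fin; toℕ)
  import Data.Fin.Properties as Fin
  open import Data.List using (List; []; _∷_; length; filter; map; allFin; applyUpTo)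
  open import Data.List.Properties using (length-map; length-applyUpTo; length-tabulate)
  open import Data.List.Membership.Propositional using (_∈_; lose)
  open import Data.List.Membership.Propositional.Properties
  open import Data.List.Relation.Unary.Any as Any using (here; any?)
  open import Data.List.Relation.Unary.All as All using (all?)
  open import Data.List.Relation.Unary.AllPairs using (_∷_; [])
  open import Data.List.Relation.Unary.Unique.Propositional using (Unique)
  import Data.List.Relation.Unary.Unique.Propositional.Properties as Unique
  open import Data.Product hiding (map)
  open import Data.Sum using (inj₁; inj₂)
  open import Data.Empty using (⊥-elim)
  open import Relation.Nullary
  open import Relation.Nullary.Decidable using (map′; _×-dec_)
  open import Relation.Binary.PropositionalEquality
  open import Function.Bundles using (_↔_; Inverse)

  open GroupFacts H
  open Inverse enum using (to; from)
  open ≡-Reasoning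

  from-to : ∀ a → from (to a) ≡ a
  from-to a = Inverse.inverseʳ enum refl

  to-injective : ∀ {a b} → to a ≡ to b → a ≡ b
  to-injective {a} {b} e = trans (sym (from-to a)) (trans (cong from e) (from-to b))

  _≟_ : (a b : Carrier) → Dec (a ≡ b)
  a ≟ b = map′ to-injective (cong to) (to a Fin.≟ to b)

  elements : List Carrier
  elements = map from (allFin n)

  elements-complete : ∀ a → a ∈ elements
  elements-complete a = subst (_∈ elements) (from-to a) (∈-map⁺ from (∈-allFin (to a)))

  elements-unique : Unique elements
  elements-unique = Unique.map⁺ (λ {i} {j} e → trans (sym (to-from i)) (trans (cong to e) (to-from j)))
                                 (Unique.allFin⁺ n)
    where to-from : ∀ i → to (from i) ≡ i
          to-from i = Inverse.inverseˡ enum refl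

  elements-length : length elements ≡ n
  elements-length = trans (length-map from (allFin n)) (length-tabulate {n = n} (λ i → i))

  ∃? : (P : Carrier → Set) → (∀ a → Dec (P a)) → Dec (Σ Carrier P)
  ∃? P P? with any? P? elements
  ... | yes p∈ = yes (Any.satisfied p∈)
  ... | no ¬p∈ = no λ { (a , pa) → ¬p∈ (lose (elements-complete a) pa) }

  ∀? : (P : Carrier → Set) → (∀ a → Dec (P a)) → Dec (∀ a → P a)
  ∀? P P? with all? P? elements
  ... | yes all = yes (λ a → All.lookup all (elements-complete a))
  ... | no ¬all = no λ p → ¬all (All.tabulate (λ {a} _ → p a))

  module Classes (R : Carrier → Carrier → Set) (R? : ∀ a b → Dec (R a b))
    (R-refl : ∀ a → R a a) (R-sym : ∀ {a b} → R a b → R b a)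
    (R-trans : ∀ {a b c} → R a b → R b c → R a c) where
    open Representatives _≟_ elements elements-unique elements-complete R R? R-refl R-sym R-trans public

    card-by-classes : n ≡ sumOver Reps (λ c → count (R? c) elements)
    card-by-classes = trans (sym elements-length) class-sum

  pow-cancel : ∀ a i j → i < j → pw a i ≡ pw a j → pw a (j ∸ i) ≡ ε
  pow-cancel a i j i<j aⁱ≡aʲ = sym (∙-cancelˡ (pw a i) ε (pw a (j ∸ i)) (begin
    pw a i ∙ ε              ≡⟨ identityʳ _ ⟩
    pw a i                  ≡⟨ aⁱ≡aʲ ⟩
    pw a j                  ≡⟨ cong (pw a) (m+[n∸m]≡n (<⇒≤ i<j)) ⟨
    pw a (i + (j ∸ i))      ≡⟨ pow-add a i (j ∸ i) ⟩
    pw a i ∙ pw a (j ∸ i)   ∎))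

  -- by the pigeonhole principle among a⁰, …, aⁿ every element has a period
  has-period : ∀ a → Σ ℕ λ d → 0 < d × pw a d ≡ ε
  has-period a with Fin.pigeonhole (n<1+n n) (λ i → to (pw a (toℕ i)))
  ... | i , j , i<j , e = toℕ j ∸ toℕ i , m<n⇒0<n∸m i<j , pow-cancel a (toℕ i) (toℕ j) i<j (to-injective e)

  -- Lagrange for the cyclic subgroup ⟨a⟩: the cosets b⟨a⟩ all have o(a)
  -- elements and partition H, so o(a) divides n and a ^ n = 1.
  module Order (a : Carrier) where
    Period : ℕ → Set
    Period j = 0 < j × pw a j ≡ ε

    Period? : ∀ j → Dec (Period j)
    Period? j = (0 <? j) ×-dec (pw a j ≟ ε)

    least-period : Σ ℕ λ o → Period o × (∀ j → j < o → ¬ Period j)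
    least-period = let (d , period) = has-period a in least Period Period? d period

    o : ℕ
    o = proj₁ least-period

    instance
      o-nonZero : NonZero o
      o-nonZero = >-nonZero (proj₁ (proj₁ (proj₂ least-period)))

    pow-o : pw a o ≡ ε
    pow-o = proj₂ (proj₁ (proj₂ least-period))

    o-minimal : ∀ j → 0 < j → j < o → pw a j ≢ ε
    o-minimal j 0<j j<o aʲ≡ε = proj₂ (proj₂ least-period) j j<o (0<j , aʲ≡ε)

    pow-mod : ∀ i → pw a i ≡ pw a (i % o)
    pow-mod i = begin
      pw a i                              ≡⟨ cong (pw a) (m≡m%n+[m/n]*n i o) ⟩
      pw a (i % o + (i / o) * o)          ≡⟨ pow-add a (i % o) _ ⟩
      pw a (i % o) ∙ pw a ((i / o) * o)   ≡⟨ cong (pw a (i % o) ∙_) (pow-multiple a o pow-o (i / o)) ⟩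
      pw a (i % o) ∙ ε                    ≡⟨ identityʳ _ ⟩
      pw a (i % o)                        ∎

    SameCoset : Carrier → Carrier → Set
    SameCoset b c = Σ ℕ λ i → b ∙ pw a i ≡ c

    SameCoset? : ∀ b c → Dec (SameCoset b c)
    SameCoset? b c with anyUpTo? (λ i → (b ∙ pw a i) ≟ c) o
    ... | yes (i , _ , e) = yes (i , e)
    ... | no ¬small = no λ { (i , e) →
            ¬small (i % o , m%n<n i o , trans (cong (b ∙_) (sym (pow-mod i))) e) }

    coset-refl : ∀ b → SameCoset b b
    coset-refl b = 0 , identityʳ b

    coset-sym : ∀ {b c} → SameCoset b c → SameCoset c b
    coset-sym {b} (i , refl) = i * (o ∸ 1) , (begin
      (b ∙ pw a i) ∙ pw a (i * (o ∸ 1))  ≡⟨ assoc _ _ _ ⟩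
      b ∙ (pw a i ∙ pw a (i * (o ∸ 1)))  ≡⟨ cong (b ∙_) (pow-add a i _) ⟨
      b ∙ pw a (i + i * (o ∸ 1))         ≡⟨ cong (λ j → b ∙ pw a j) i+i[o-1]≡i*o ⟩
      b ∙ pw a (i * o)                   ≡⟨ cong (b ∙_) (pow-multiple a o pow-o i) ⟩
      b ∙ ε                              ≡⟨ identityʳ b ⟩
      b                                  ∎)
      where
        i+i[o-1]≡i*o : i + i * (o ∸ 1) ≡ i * o
        i+i[o-1]≡i*o = trans (cong (_+ i * (o ∸ 1)) (sym (*-identityʳ i)))
          (trans (sym (*-distribˡ-+ i 1 (o ∸ 1))) (cong (i *_) (m+[n∸m]≡n {1} {o} (>-nonZero⁻¹ o))))

    coset-trans : ∀ {b c d} → SameCoset b c → SameCoset c d → SameCoset b d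
    coset-trans {b} (i , refl) (j , refl) = i + j , trans (cong (b ∙_) (pow-add a i j)) (sym (assoc _ _ _))

    -- the coset b⟨a⟩ is listed without repetition by b a⁰, …, b a^(o-1)
    coset-size : ∀ b → count (SameCoset? b) elements ≡ o
    coset-size b = trans (count-list (SameCoset? b) elements coset elements-unique distinct
                            (λ c∈ → elements-complete _ , listed c∈) (λ _ → in-list))
                         (length-applyUpTo _ o)
      where
        coset : List Carrier
        coset = applyUpTo (λ i → b ∙ pw a i) o
        distinct : Unique coset
        distinct = Unique.applyUpTo⁺₁ _ o (λ {i} {j} i<j j<o e →
          o-minimal (j ∸ i) (m<n⇒0<n∸m i<j) (≤-<-trans (m∸n≤m j i) j<o)
            (pow-cancel a i j i<j (∙-cancelˡ b _ _ e)))
        listed : ∀ {c} → c ∈ coset → SameCoset b c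
        listed c∈ with ∈-applyUpTo⁻ (λ i → b ∙ pw a i) c∈
        ... | i , _ , refl = i , refl
        in-list : ∀ {c} → SameCoset b c → c ∈ coset
        in-list (i , refl) = subst (_∈ coset) (cong (b ∙_) (sym (pow-mod i)))
          (∈-applyUpTo⁺ (λ i → b ∙ pw a i) (m%n<n i o))

    open Classes SameCoset SameCoset? coset-refl coset-sym coset-trans using (Reps; card-by-classes)

    pow-card : pw a n ≡ ε
    pow-card = begin
      pw a n                       ≡⟨ cong (pw a) (trans card-by-classes (sumOver-const Reps _ o (λ {c} _ → coset-size c))) ⟩
      pw a (length Reps * o)       ≡⟨ pow-multiple a o pow-o (length Reps) ⟩
      ε                            ∎

  pow-card : ∀ a → pw a n ≡ ε
  pow-card a = Order.pow-card a

  -- An action of H on its own underlying set.  When |H| = p ^ k every orbit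
  -- has size 1 or a multiple of p, so |H| ≡ |Fix| (mod p).
  module Action (act : Carrier → Carrier → Carrier) (act-ε : ∀ b → act ε b ≡ b)
    (act-∙ : ∀ g h b → act (g ∙ h) b ≡ act g (act h b))
    {p : ℕ} (prime : Prime p) (k : ℕ) (n≡pᵏ : n ≡ p ^ k) where

    SameOrbit : Carrier → Carrier → Set
    SameOrbit b c = Σ Carrier λ h → act h b ≡ c

    SameOrbit? : ∀ b c → Dec (SameOrbit b c)
    SameOrbit? b c = ∃? (λ h → act h b ≡ c) (λ h → act h b ≟ c)

    Fixed : Carrier → Set
    Fixed b = ∀ h → act h b ≡ b

    Fixed? : ∀ b → Dec (Fixed b)
    Fixed? b = ∀? (λ h → act h b ≡ b) (λ h → act h b ≟ b)

    Stabilises? : ∀ b h → Dec (act h b ≡ b)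
    Stabilises? b h = act h b ≟ b

    orbit-stabiliser : ∀ b → n ≡ count (SameOrbit? b) elements * count (Stabilises? b) elements
    orbit-stabiliser b = begin
      n                  ≡⟨ elements-length ⟨
      length elements    ≡⟨ fiber-sum _≟_ (λ h → act h b) elements orbit (Unique.filter⁺ (SameOrbit? b) elements-unique)
                               (λ {h} _ → ∈-filter⁺ (SameOrbit? b) (elements-complete _) (h , refl)) ⟩
      sumOver orbit (λ s → count (λ h → act h b ≟ s) elements)
                         ≡⟨ sumOver-const orbit _ _ fibre-size ⟩
      count (SameOrbit? b) elements * count (Stabilises? b) elements ∎
      where
        orbit : List Carrier
        orbit = filter (SameOrbit? b) elements
        -- the fibre over h₀ b is the coset h₀ · Stab(b)
        fibre-size : ∀ {s} → s ∈ orbit → count (λ h → act h b ≟ s) elements ≡ count (Stabilises? b) elements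
        fibre-size s∈ with proj₂ (∈-filter⁻ (SameOrbit? b) {xs = elements} s∈)
        ... | h₀ , refl = count-bij (Stabilises? b) (λ h → act h b ≟ act h₀ b) (h₀ ⁻¹ ∙_) (h₀ ∙_)
          (cancelˡ-⁻¹ h₀) (⁻¹-cancelˡ h₀)
          (λ h e → trans (act-∙ _ _ _) (trans (cong (act (h₀ ⁻¹)) e)
                     (trans (sym (act-∙ _ _ _)) (trans (cong (λ g → act g b) (inverseˡ h₀)) (act-ε b)))))
          (λ h e → trans (cong (λ g → act g b) (sym (cancelˡ-⁻¹ h₀ h))) (trans (act-∙ _ _ _) (cong (act h₀) e)))
          elements elements-unique elements-complete

    orbit-size : ∀ b → Σ ℕ λ t → count (SameOrbit? b) elements ≡ indicator (Fixed? b) + p * t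
    orbit-size b with Fixed? b
    ... | yes fixed = 0 , trans
            (count-list (SameOrbit? b) elements (b ∷ []) elements-unique (All.[] ∷ [])
               (λ { (here refl) → elements-complete b , ε , act-ε b })
               (λ { _ (h , refl) → here (fixed h) }))
            (sym (cong suc (*-zeroʳ p)))
    ... | no ¬fixed
      with prime-power-divisor-1-or-p prime k (count (SameOrbit? b) elements)
             (divides (count (Stabilises? b) elements)
               (trans (sym n≡pᵏ) (trans (orbit-stabiliser b) (*-comm (count (SameOrbit? b) elements) _))))
    ...   | inj₂ (divides t e) = t , trans e (*-comm t p)
    ...   | inj₁ size≡1 = ⊥-elim (¬fixed λ h →
              count-1-unique _≟_ (SameOrbit? b) elements elements-unique size≡1 (act h b) b
                (elements-complete _) (elements-complete _) (h , refl) (ε , act-ε b))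

    orbit-refl : ∀ b → SameOrbit b b
    orbit-refl b = ε , act-ε b

    orbit-sym : ∀ {b c} → SameOrbit b c → SameOrbit c b
    orbit-sym {b} (h , refl) =
      h ⁻¹ , trans (sym (act-∙ _ _ _)) (trans (cong (λ g → act g b) (inverseˡ h)) (act-ε b))

    orbit-trans : ∀ {b c d} → SameOrbit b c → SameOrbit c d → SameOrbit b d
    orbit-trans {b} (h , refl) (g , refl) = g ∙ h , act-∙ g h b

    open Classes SameOrbit SameOrbit? orbit-refl orbit-sym orbit-trans
      using (Reps; Canonical; Canonical?; rep-R; card-by-classes)

    fixed-canonical : ∀ c → Fixed c → Canonical c
    fixed-canonical c fixed with rep-R c
    ... | h , e = trans (sym e) (fixed h)

    fixed-point-congruence : Σ ℕ λ t → n ≡ count Fixed? elements + p * t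
    fixed-point-congruence with sumOver-mod p Reps (λ c → count (SameOrbit? c) elements)
                                  (λ c → indicator (Fixed? c)) (λ {c} _ → orbit-size c)
    ... | t , orbits≡fixed = t , (begin
      n                                                   ≡⟨ card-by-classes ⟩
      sumOver Reps (λ c → count (SameOrbit? c) elements)  ≡⟨ orbits≡fixed ⟩
      sumOver Reps (λ c → indicator (Fixed? c)) + p * t   ≡⟨ cong (_+ p * t) (sumOver-indicator Fixed? Reps) ⟩
      count Fixed? Reps + p * t                           ≡⟨ cong (_+ p * t)
                                                               (count-filter Fixed? Canonical? elements fixed-canonical) ⟩
      count Fixed? elements + p * t                       ∎)

-- The centre of a nontrivial finite p-group is nontrivial, in the form
-- needed without quotients: if M is a proper normal subgroup of a group H of
-- order p ^ k, some r ∉ M is central modulo M.  Proof: H acts by conjugation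
-- on the cosets of M (represented canonically); the class equation shows
-- that the number of fixed cosets is divisible by p, and M itself is one.
module CentreModulo (H : Grp) {p : ℕ} (prime : Prime p) (k : ℕ)
  (enum : Grp.Carrier H ↔ Fin (p ^ k)) (M : NormalSubgroups.NormalSubgroup H) where
  open Counting
  open Arithmetic
  open import Data.Nat hiding (_≟_)
  open import Data.Nat.Properties hiding (_≟_)
  open import Data.Nat.Primality using (Prime; ¬prime[1])
  open import Data.Nat.Divisibility using (_∣_; divides; ∣m+n∣m⇒∣n; ∣1⇒≡1)
  open import Data.Fin using (Fin)
  open import Data.List using ([]; _∷_; length)
  open import Data.List.Relation.Unary.Any using (here)
  open import Data.List.Relation.Unary.All as All using ()
  open import Data.List.Relation.Unary.AllPairs using (_∷_; [])
  open import Data.Product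
  open import Data.Sum using ([_,_]′)
  open import Function using (id)
  open import Data.Empty using (⊥-elim)
  open import Relation.Nullary
  open import Relation.Nullary.Decidable using (_×-dec_; decidable-stable)
  open import Relation.Binary.PropositionalEquality
  open import Function.Bundles using (_↔_)

  open GroupFacts H
  open FiniteGroups H (p ^ k) enum
  open NormalSubgroups H
  open NormalSubgroup M
  open Modulo M

  ≈? : ∀ a b → Dec (a ≈ b)
  ≈? a b = In? (a ⁻¹ ∙ b)

  open Classes _≈_ ≈? ≈-refl ≈-sym ≈-trans

  coset-size : ∀ b → count (≈? b) elements ≡ count In? elements
  coset-size b = count-bij In? (≈? b) (b ⁻¹ ∙_) (b ∙_) (cancelˡ-⁻¹ b) (⁻¹-cancelˡ b)
                   (λ _ a∈ → a∈) (λ _ a∈ → a∈) elements elements-unique elements-complete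

  index : ℕ
  index = length Reps

  lagrange : p ^ k ≡ index * count In? elements
  lagrange = trans card-by-classes
    (sumOver-const Reps (λ c → count (≈? c) elements) (count In? elements) (λ {c} _ → coset-size c))

  two-cosets : (a : Carrier) → ¬ In a → 2 ≤ index
  two-cosets a a∉M =
    count-two Canonical? elements elements-unique (rep a) (rep ε) rep-a≢rep-ε
      (elements-complete _) (elements-complete _) (rep-canonical a) (rep-canonical ε)
    where
      rep-a≢rep-ε : rep a ≢ rep ε
      rep-a≢rep-ε e = a∉M (ε≈⇒In (≈-sym (≈-trans (rep-R a) (subst (_≈ ε) (sym e) (≈-sym (rep-R ε))))))

  -- so its index, a divisor of p ^ k other than 1, is divisible by p
  p∣index : (a : Carrier) → ¬ In a → p ∣ index
  p∣index a a∉M = [ (λ index≡1 → ⊥-elim (1+n≰n (subst (2 ≤_) index≡1 (two-cosets a a∉M)))) , id ]′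
    (prime-power-divisor-1-or-p prime k index
       (divides (count In? elements) (trans lagrange (*-comm index (count In? elements)))))

  conj : Carrier → Carrier → Carrier
  conj h r = (h ∙ r) ∙ h ⁻¹

  conj-ε : ∀ r → conj ε r ≡ r
  conj-ε r = trans (cong₂ _∙_ (identityˡ r) ε⁻¹≡ε) (identityʳ r)

  conj-∙ : ∀ g h r → conj (g ∙ h) r ≡ conj g (conj h r)
  conj-∙ g h r = trans (cong (((g ∙ h) ∙ r) ∙_) (⁻¹-anti-homo-∙ g h))
    (∙-Solver.solve 5 (λ g h r h′ g′ → ((g ⊕ h) ⊕ r) ⊕ (h′ ⊕ g′) ⊜ (g ⊕ ((h ⊕ r) ⊕ h′)) ⊕ g′)
       refl g h r (h ⁻¹) (g ⁻¹))
    where open ∙-Solver using (_⊕_; _⊜_)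

  -- conjugation permutes the canonical coset representatives and fixes the
  -- remaining elements, which makes it an action on all of H
  conj-rep : (r : Carrier) → Dec (Canonical r) → Carrier → Carrier
  conj-rep r (yes _) h = rep (conj h r)
  conj-rep r (no _)  h = r

  act : Carrier → Carrier → Carrier
  act h r = conj-rep r (Canonical? r) h

  act-ε : ∀ r → act ε r ≡ r
  act-ε r with Canonical? r
  ... | yes r-canonical = trans (rep-eq (≈-reflexive (conj-ε r))) r-canonical
  ... | no _            = refl

  act-non-canonical : ∀ r → ¬ Canonical r → ∀ h → act h r ≡ r
  act-non-canonical r ¬canonical h with Canonical? r
  ... | yes canonical = ⊥-elim (¬canonical canonical)
  ... | no _          = refl

  act-∙ : ∀ g h r → act (g ∙ h) r ≡ act g (act h r)
  act-∙ g h r with Canonical? r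
  ... | no ¬canonical = sym (act-non-canonical r ¬canonical g)
  ... | yes _ with Canonical? (rep (conj h r))
  ...   | no ¬canonical = ⊥-elim (¬canonical (rep-canonical _))
  ...   | yes _ = rep-eq (≈-trans (≈-reflexive (conj-∙ g h r))
                    (∙-congʳ (g ⁻¹) (∙-congˡ g (rep-R (conj h r)))))

  open Action act act-ε act-∙ prime k refl using (Fixed; Fixed?; fixed-point-congruence)

  CentralRep? : ∀ a → Dec (Fixed a × Canonical a)
  CentralRep? a = Fixed? a ×-dec Canonical? a

  -- index ≡ #(central cosets)  (mod p), since non-canonical elements are fixed
  index-congruence : Σ ℕ λ t → index ≡ count CentralRep? elements + p * t
  index-congruence = t , +-cancelʳ-≡ #non-canonical index (#central + p * t) (begin
    index + #non-canonical                      ≡⟨ count-split Canonical? elements ⟨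
    length elements                             ≡⟨ elements-length ⟩
    p ^ k                                       ≡⟨ pᵏ≡fix ⟩
    count Fixed? elements + p * t               ≡⟨ cong (_+ p * t) (count-split-by Fixed? Canonical? elements) ⟩
    (#central + #fixed-non-canonical) + p * t   ≡⟨ cong (λ z → (#central + z) + p * t)
                                                     (count-ext Fixed-non-canonical? Non-canonical? elements
                                                        (λ _ → proj₂) (λ a nc → fixed a nc , nc)) ⟩
    (#central + #non-canonical) + p * t         ≡⟨ +-assoc #central #non-canonical (p * t) ⟩
    #central + (#non-canonical + p * t)         ≡⟨ cong (#central +_) (+-comm #non-canonical (p * t)) ⟩
    #central + (p * t + #non-canonical)         ≡⟨ +-assoc #central (p * t) #non-canonical ⟨
    (#central + p * t) + #non-canonical         ∎)
    where
      open ≡-Reasoning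
      t : ℕ
      t = proj₁ fixed-point-congruence
      pᵏ≡fix : p ^ k ≡ count Fixed? elements + p * t
      pᵏ≡fix = proj₂ fixed-point-congruence
      Non-canonical? : ∀ a → Dec (¬ Canonical a)
      Non-canonical? a = ¬? (Canonical? a)
      Fixed-non-canonical? : ∀ a → Dec (Fixed a × ¬ Canonical a)
      Fixed-non-canonical? a = Fixed? a ×-dec ¬? (Canonical? a)
      #non-canonical #central #fixed-non-canonical : ℕ
      #non-canonical = count Non-canonical? elements
      #central = count CentralRep? elements
      #fixed-non-canonical = count Fixed-non-canonical? elements
      fixed : ∀ a → ¬ Canonical a → Fixed a
      fixed a ¬canonical = act-non-canonical a ¬canonical

  rep-ε-central : Fixed (rep ε) × Canonical (rep ε)
  rep-ε-central = fixed , rep-canonical ε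
    where
      fixed : Fixed (rep ε)
      fixed h with Canonical? (rep ε)
      ... | no _  = refl
      ... | yes _ = rep-eq (In⇒≈ε (In-conj h (rep ε) (ε≈⇒In (rep-R ε))))

  fixed-central : ∀ r → Fixed r → Canonical r → Central r
  fixed-central r fixed r-canonical h = ≈-sym (begin
    r ∙ h                     ≈⟨ ∙-congʳ h r≈conj ⟩
    conj h r ∙ h              ≡⟨ trans (assoc _ _ _) (trans (cong ((h ∙ r) ∙_) (inverseˡ h)) (identityʳ _)) ⟩
    h ∙ r                     ∎)
    where
      open ≈-Reasoning
      act≡rep : (d : Dec (Canonical r)) → conj-rep r d h ≡ rep (conj h r)
      act≡rep (yes _)          = refl
      act≡rep (no ¬canonical)  = ⊥-elim (¬canonical r-canonical)
      r≈conj : r ≈ conj h r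
      r≈conj = rep≡⇒R (trans (sym (act≡rep (Canonical? r))) (fixed h))

  -- If M were the only central coset, the congruence index ≡ 1 (mod p)
  -- would contradict p ∣ index.
  another-central-coset : (a : Carrier) → ¬ In a →
    ¬ (∀ r → Fixed r × Canonical r → r ≡ rep ε)
  another-central-coset a a∉M only-rep-ε = ¬prime[1] (subst Prime (∣1⇒≡1 p∣1) prime)
    where
      t : ℕ
      t = proj₁ index-congruence
      Is-rep-ε? : ∀ r → Dec (r ≡ rep ε)
      Is-rep-ε? r = r ≟ rep ε
      one-rep-ε : count Is-rep-ε? elements ≡ 1
      one-rep-ε = count-list Is-rep-ε? elements (rep ε ∷ []) elements-unique (All.[] ∷ [])
                    (λ { (here refl) → elements-complete _ , refl }) (λ { _ refl → here refl })
      #central≡1 : count CentralRep? elements ≡ 1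
      #central≡1 = ≤-antisym
        (subst (count CentralRep? elements ≤_) one-rep-ε
           (count-mono CentralRep? Is-rep-ε? elements only-rep-ε))
        (count-one CentralRep? elements (rep ε) (elements-complete _) rep-ε-central)
      p∣1 : p ∣ 1
      p∣1 = ∣m+n∣m⇒∣n (subst (p ∣_) (trans (proj₂ index-congruence)
                                    (trans (cong (_+ p * t) #central≡1) (+-comm 1 (p * t))))
                             (p∣index a a∉M))
                       (divides t (*-comm p t))

  central-element : (a : Carrier) → ¬ In a → Σ Carrier λ r → ¬ In r × Central r
  central-element a a∉M = choose (∃? (λ r → (Fixed r × Canonical r) × r ≢ rep ε)
                                     (λ r → CentralRep? r ×-dec ¬? (r ≟ rep ε)))
    where
      choose : Dec (Σ Carrier λ r → (Fixed r × Canonical r) × r ≢ rep ε) →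
               Σ Carrier λ r → ¬ In r × Central r
      choose (yes (r , (fixed , r-canonical) , r≢rep-ε)) =
        r , (λ r∈M → r≢rep-ε (trans (sym r-canonical) (rep-eq (In⇒≈ε r∈M))))
          , fixed-central r fixed r-canonical
      choose (no none) = ⊥-elim (another-central-coset a a∉M λ r central →
        decidable-stable (r ≟ rep ε) (λ r≢rep-ε → none (r , central , r≢rep-ε)))

-- Given a τ-invariant normal subgroup M, a
-- "layer" is an element g, central modulo M, with g ^ p ∈ M and
-- τ g ≡ g^(±1) modulo M.  Adjoining g to M gives a τ-invariant normal
-- subgroup M⟨g⟩ with M⟨g⟩/M cyclic; when M ≠ H the layer can be chosen
-- with g ∉ M, so M⟨g⟩ is strictly larger.
module Layers (H : Grp) {p : ℕ} (prime : Prime p) (k : ℕ) (enum : Grp.Carrier H ↔ Fin (p ^ k))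
  (τ : Grp.Carrier H → Grp.Carrier H) (τ-∙ : ∀ a b → τ (Grp._∙_ H a b) ≡ Grp._∙_ H (τ a) (τ b))
  (τ-τ : ∀ a → τ (τ a) ≡ a) where
  open import Data.Nat hiding (_≟_)
  open import Data.Nat.Properties hiding (_≟_)
  open import Data.Nat.DivMod
  open import Data.Nat.Primality using (Prime; prime⇒nonZero)
  open import Data.Fin using (Fin)
  open import Data.Product
  open import Data.Sum using (_⊎_; inj₁; inj₂)
  open import Data.Empty using (⊥-elim)
  open import Relation.Nullary
  open import Relation.Binary.PropositionalEquality
  open import Function.Bundles using (_↔_)

  open GroupFacts H
  open FiniteGroups H (p ^ k) enum using (pow-card)
  open NormalSubgroups H
  open Homomorphism τ τ-∙

  instance
    p-nonZero : NonZero p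
    p-nonZero = prime⇒nonZero prime

  TauInvariant : NormalSubgroup → Set
  TauInvariant M = ∀ a → NormalSubgroup.In M a → NormalSubgroup.In M (τ a)

  module _ (M : NormalSubgroup) (τ-In : TauInvariant M) where
    open NormalSubgroup M
    open Modulo M
    open Involution τ τ-∙ τ-τ τ-In

    record Layer : Set where
      field
        g         : Carrier
        g^p∈M     : In (pw g p)
        g-central : Central g
        τ-on-g    : (τ g ≈ g) ⊎ (τ g ≈ g ⁻¹)

    -- used once the series has reached H
    trivial-layer : Layer
    trivial-layer = record
      { g = ε ; g^p∈M = subst In (sym (pow-ε p)) In-ε ; g-central = Central-ε ; τ-on-g = inj₁ (≈-reflexive f-ε) }

    -- From a central g₀ ∉ M with g₀ ^ p ∈ M: either τ g₀ ≈ g₀⁻¹, or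
    -- g₀ τ(g₀) ∉ M is a τ-fixed central element with the same property.
    τ-adapt : (g₀ : Carrier) → ¬ In g₀ → In (pw g₀ p) → Central g₀ → Σ Layer λ L → ¬ In (Layer.g L)
    τ-adapt g₀ g₀∉M g₀^p∈M g₀-central with In? (g₀ ∙ τ g₀)
    ... | yes g₀τg₀∈M = record { g = g₀ ; g^p∈M = g₀^p∈M ; g-central = g₀-central
                               ; τ-on-g = inj₂ (≈-sym (⁻¹-unique (In⇒≈ε g₀τg₀∈M))) } , g₀∉M
    ... | no g₀τg₀∉M = record { g = g₀ ∙ τ g₀ ; g^p∈M = power∈M
                              ; g-central = Central-∙ g₀-central (Central-τ g₀-central)
                              ; τ-on-g = inj₁ τ-fixed } , g₀τg₀∉M
      where
        power∈M : In (pw (g₀ ∙ τ g₀) p)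
        power∈M = In-resp (≈-sym (pow-∙ (τ g₀) p g₀-central))
                    (In-∙ _ _ g₀^p∈M (subst In (f-pow g₀ p) (τ-In _ g₀^p∈M)))
        τ-fixed : τ (g₀ ∙ τ g₀) ≈ g₀ ∙ τ g₀
        τ-fixed = ≈-trans (≈-reflexive (trans (τ-∙ g₀ (τ g₀)) (cong (τ g₀ ∙_) (τ-τ g₀)))) (g₀-central (τ g₀))

    order-p-element : (r : Carrier) → ¬ In r → Central r → (j : ℕ) → In (pw r (p ^ j)) →
      Σ Carrier λ g₀ → ¬ In g₀ × In (pw g₀ p) × Central g₀
    order-p-element r r∉M r-central zero    r^1∈M = ⊥-elim (r∉M (subst In (identityʳ r) r^1∈M))
    order-p-element r r∉M r-central (suc j) r^pʲ⁺¹∈M with In? (pw r (p ^ j))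
    ... | yes r^pʲ∈M = order-p-element r r∉M r-central j r^pʲ∈M
    ... | no r^pʲ∉M = pw r (p ^ j) , r^pʲ∉M
                    , subst In (trans (cong (pw r) (*-comm p (p ^ j))) (pow-mul r (p ^ j) p)) r^pʲ⁺¹∈M
                    , Central-pow (p ^ j) r-central

    -- When M ≠ H there is a layer outside M: take a central element modulo M
    -- (nontrivial centre of H/M), then a power of order p, then adapt to τ.
    proper-layer : (a : Carrier) → ¬ In a → Σ Layer λ L → ¬ In (Layer.g L)
    proper-layer a a∉M =
      let (r , r∉M , r-central) = CentreModulo.central-element H prime k enum M a a∉M
          (g₀ , g₀∉M , g₀^p∈M , g₀-central) =
            order-p-element r r∉M r-central k (subst In (sym (pow-card r)) In-ε)
      in τ-adapt g₀ g₀∉M g₀^p∈M g₀-central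

    module Extend (L : Layer) where
      open Layer L

      Mg : Carrier → Set
      Mg h = Σ ℕ λ i → pw g i ≈ h

      pow-multiple-p : ∀ q → pw g (q * p) ≈ ε
      pow-multiple-p q = ≈-trans (≈-reflexive (trans (cong (pw g) (*-comm q p)) (pow-mul g p q)))
                                 (pow-≈ε q (In⇒≈ε g^p∈M))

      pow-mod-p : ∀ i → pw g (i % p) ≈ pw g i
      pow-mod-p i = ≈-sym (begin
        pw g i                          ≡⟨ cong (pw g) (m≡m%n+[m/n]*n i p) ⟩
        pw g (i % p + (i / p) * p)      ≡⟨ pow-add g (i % p) _ ⟩
        pw g (i % p) ∙ pw g ((i / p) * p) ≈⟨ ∙-congˡ (pw g (i % p)) (pow-multiple-p (i / p)) ⟩
        pw g (i % p) ∙ ε                ≡⟨ identityʳ _ ⟩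
        pw g (i % p)                    ∎)
        where open ≈-Reasoning

      pow-inverse : ∀ i → (pw g i) ⁻¹ ≈ pw g (i * (p ∸ 1))
      pow-inverse i = ⁻¹-unique (≈-trans (≈-reflexive (sym (pow-add g i _)))
                                          (≈-trans (≈-reflexive (cong (pw g) i+i[p-1]≡i*p)) (pow-multiple-p i)))
        where
          i+i[p-1]≡i*p : i + i * (p ∸ 1) ≡ i * p
          i+i[p-1]≡i*p = trans (cong (_+ i * (p ∸ 1)) (sym (*-identityʳ i)))
            (trans (sym (*-distribˡ-+ i 1 (p ∸ 1))) (cong (i *_) (m+[n∸m]≡n {1} {p} (>-nonZero⁻¹ p))))

      Mg? : ∀ h → Dec (Mg h)
      Mg? h with anyUpTo? (λ i → In? (pw g i ⁻¹ ∙ h)) p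
      ... | yes (i , _ , gⁱ≈h) = yes (i , gⁱ≈h)
      ... | no ¬small = no λ { (i , gⁱ≈h) → ¬small (i % p , m%n<n i p , ≈-trans (pow-mod-p i) gⁱ≈h) }

      Mg-conj : ∀ h a → Mg a → Mg ((h ∙ a) ∙ h ⁻¹)
      Mg-conj h a (i , gⁱ≈a) = i , ≈-sym (begin
        (h ∙ a) ∙ h ⁻¹          ≈⟨ ∙-congʳ (h ⁻¹) (∙-congˡ h gⁱ≈a) ⟨
        (h ∙ pw g i) ∙ h ⁻¹     ≈⟨ ∙-congʳ (h ⁻¹) (Central-pow i g-central h) ⟩
        (pw g i ∙ h) ∙ h ⁻¹     ≡⟨ trans (assoc _ _ _) (trans (cong (pw g i ∙_) (inverseʳ h)) (identityʳ _)) ⟩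
        pw g i                  ∎)
        where open ≈-Reasoning

      M⟨g⟩ : NormalSubgroup
      M⟨g⟩ = record
        { In = Mg ; In? = Mg? ; In-ε = 0 , ≈-refl ε
        ; In-∙ = λ { a b (i , gⁱ≈a) (j , gʲ≈b) →
                     i + j , ≈-trans (≈-reflexive (pow-add g i j)) (∙-cong gⁱ≈a gʲ≈b) }
        ; In-⁻¹ = λ { a (i , gⁱ≈a) → i * (p ∸ 1) , ≈-trans (≈-sym (pow-inverse i)) (⁻¹-cong gⁱ≈a) }
        ; In-conj = Mg-conj }

      -- τ(gⁱ) ≈ g^(±i), so M⟨g⟩ is again τ-invariant
      M⟨g⟩-τ-invariant : TauInvariant M⟨g⟩
      M⟨g⟩-τ-invariant a (i , gⁱ≈a) with τ-on-g
      ... | inj₁ τg≈g = i , (begin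
        pw g i                  ≈⟨ pow-cong i τg≈g ⟨
        pw (τ g) i              ≡⟨ f-pow g i ⟨
        τ (pw g i)              ≈⟨ τ-≈ gⁱ≈a ⟩
        τ a                     ∎)
        where open ≈-Reasoning
      ... | inj₂ τg≈g⁻¹ = i * (p ∸ 1) , (begin
        pw g (i * (p ∸ 1))      ≈⟨ pow-inverse i ⟨
        (pw g i) ⁻¹             ≡⟨ pow-inv g i ⟨
        pw (g ⁻¹) i             ≈⟨ pow-cong i τg≈g⁻¹ ⟨
        pw (τ g) i              ≡⟨ f-pow g i ⟨
        τ (pw g i)              ≈⟨ τ-≈ gⁱ≈a ⟩
        τ a                     ∎)
        where open ≈-Reasoning

      M⊆M⟨g⟩ : ∀ a → In a → Mg a
      M⊆M⟨g⟩ a a∈M = 0 , In⇒ε≈ a∈M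

      g∈M⟨g⟩ : Mg g
      g∈M⟨g⟩ = 1 , ≈-reflexive (identityʳ g)

      M⟨g⟩-central : ∀ h → Mg h → Central h
      M⟨g⟩-central h (i , gⁱ≈h) = Central-resp gⁱ≈h (Central-pow i g-central)

      M⟨g⟩-τ-fixed : τ g ≈ g → ∀ h → Mg h → τ h ≈ h
      M⟨g⟩-τ-fixed τg≈g h (i , gⁱ≈h) = begin
        τ h                     ≈⟨ τ-≈ gⁱ≈h ⟨
        τ (pw g i)              ≡⟨ f-pow g i ⟩
        pw (τ g) i              ≈⟨ pow-cong i τg≈g ⟩
        pw g i                  ≈⟨ gⁱ≈h ⟩
        h                       ∎
        where open ≈-Reasoning

-- The τ-invariant series 1 = M 0 ≤ M 1 ≤ … of H obtained by adjoining
-- layers one at a time.  Each proper step enlarges M, so M n = H for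
-- n = p ^ k = |H|; from then on the steps are trivial.
module Series (H : Grp) {p : ℕ} (prime : Prime p) (k : ℕ) (enum : Grp.Carrier H ↔ Fin (p ^ k))
  (τ : Grp.Carrier H → Grp.Carrier H) (τ-∙ : ∀ a b → τ (Grp._∙_ H a b) ≡ Grp._∙_ H (τ a) (τ b))
  (τ-τ : ∀ a → τ (τ a) ≡ a) where
  open Counting using (count; count-≤; count-one; count-strict)
  open import Data.Nat hiding (_≟_)
  open import Data.Nat.Properties hiding (_≟_)
  open import Data.Nat.Primality using (Prime)
  open import Data.Fin using (Fin)
  open import Data.Product
  open import Data.Sum using (_⊎_; inj₁; inj₂)
  open import Data.Empty using (⊥-elim)
  open import Relation.Nullary
  open import Relation.Nullary.Decidable using (decidable-stable)
  open import Relation.Binary.PropositionalEquality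
  open import Function.Bundles using (_↔_)

  open GroupFacts H
  open FiniteGroups H (p ^ k) enum using (_≟_; ∃?; elements; elements-complete; elements-length)
  open NormalSubgroups H
  open Layers H prime k enum τ τ-∙ τ-τ
  open Homomorphism τ τ-∙

  n : ℕ
  n = p ^ k

  record Stage : Set₁ where
    field
      subgroup    : NormalSubgroup
      τ-invariant : TauInvariant subgroup

  trivial-subgroup : NormalSubgroup
  trivial-subgroup =
    let (ε∈ , ∙-closed , ⁻¹-closed , conj-closed) = trivial-normal
    in record { In = _≡ ε ; In? = _≟ ε ; In-ε = ε∈ ; In-∙ = ∙-closed ; In-⁻¹ = ⁻¹-closed ; In-conj = conj-closed }

  stage₀ : Stage
  stage₀ = record { subgroup = trivial-subgroup ; τ-invariant = λ { a refl → f-ε } }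

  module _ (S : Stage) where
    open Stage S
    open NormalSubgroup subgroup

    next-layer : Σ (Layer subgroup τ-invariant) λ L → (∀ a → In a) ⊎ ¬ In (Layer.g L)
    next-layer with ∃? (λ a → ¬ In a) (λ a → ¬? (In? a))
    ... | yes (a , a∉M) = let (L , g∉M) = proper-layer subgroup τ-invariant a a∉M in L , inj₂ g∉M
    ... | no none = trivial-layer subgroup τ-invariant ,
                    inj₁ (λ a → decidable-stable (In? a) (λ a∉M → none (a , a∉M)))

    layer : Layer subgroup τ-invariant
    layer = proj₁ next-layer

    next : Stage
    next = record { subgroup = Extend.M⟨g⟩ subgroup τ-invariant layer
                  ; τ-invariant = Extend.M⟨g⟩-τ-invariant subgroup τ-invariant layer }

  stage : ℕ → Stage
  stage zero    = stage₀
  stage (suc i) = next (stage i)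

  M : ℕ → Carrier → Set
  M i = NormalSubgroup.In (Stage.subgroup (stage i))

  layerᵢ : (i : ℕ) → Layer (Stage.subgroup (stage i)) (Stage.τ-invariant (stage i))
  layerᵢ i = layer (stage i)

  module Step (i : ℕ) = Extend (Stage.subgroup (stage i)) (Stage.τ-invariant (stage i)) (layerᵢ i)

  gᵢ : ℕ → Carrier
  gᵢ i = Layer.g (layerᵢ i)

  M-mono : ∀ i a → M i a → M (suc i) a
  M-mono i = Step.M⊆M⟨g⟩ i

  size : ℕ → ℕ
  size i = count (NormalSubgroup.In? (Stage.subgroup (stage i))) elements

  growth : ∀ i → (∀ a → M i a) ⊎ (suc i ≤ size i)
  growth zero = inj₂ (count-one _ elements ε (elements-complete ε) refl)
  growth (suc i) with proj₂ (next-layer (stage i)) | growth i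
  ... | inj₁ complete | _          = inj₁ (λ a → M-mono i a (complete a))
  ... | inj₂ g∉M      | inj₁ complete = ⊥-elim (g∉M (complete _))
  ... | inj₂ g∉M      | inj₂ i<size = inj₂ (<-≤-trans (s≤s i<size)
          (count-strict _ _ elements (M-mono i) (gᵢ i) (elements-complete _) (Step.g∈M⟨g⟩ i) g∉M))

  complete-at-n : ∀ a → M n a
  complete-at-n with growth n
  ... | inj₁ complete = complete
  ... | inj₂ n<size = ⊥-elim (1+n≰n (≤-trans n<size (subst (size n ≤_) elements-length (count-≤ _ elements))))

  complete : ∀ {i} → n ≤ i → ∀ a → M i a
  complete {i} n≤i a = subst (λ j → M j a) (m∸n+n≡m n≤i) (beyond (i ∸ n))
    where
      beyond : ∀ j → M (j + n) a
      beyond zero    = complete-at-n a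
      beyond (suc j) = M-mono (j + n) a (beyond j)

-- Its normal series is
--   N i = M i × {1}  (i ≤ n),   N (n + 1) = G,
-- with cyclic factors generated by the layers gᵢ and by τ; hence G is
-- supersolvable.  For p = 2 every layer satisfies gᵢ ≡ gᵢ⁻¹, so τ acts
-- trivially on M (i+1)/M i and the series is central: G is nilpotent.
module ExtendedGroup (H : Grp) {p : ℕ} (prime : Prime p) (k : ℕ) (enum : Grp.Carrier H ↔ Fin (p ^ k))
  (τ : Grp.Carrier H → Grp.Carrier H) (τ-∙ : ∀ a b → τ (Grp._∙_ H a b) ≡ Grp._∙_ H (τ a) (τ b))
  (τ-τ : ∀ a → τ (τ a) ≡ a) where
  open import Data.Nat hiding (_≟_)
  open import Data.Nat.Properties hiding (_≟_)
  open import Data.Nat.Primality using (Prime)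
  open import Data.Integer using (+_)
  open import Data.Fin using (Fin)
  open import Data.Bool using (true; false)
  open import Data.Product
  open import Data.Sum using (_⊎_; inj₁; inj₂; [_,_]′)
  open import Data.Empty using (⊥-elim)
  open import Relation.Nullary
  open import Relation.Binary.PropositionalEquality
  open import Function.Bundles using (_↔_)

  open GroupFacts H
  open NormalSubgroups H
  open Layers H prime k enum τ τ-∙ τ-τ using (module Layer; TauInvariant)
  open Series H prime k enum τ τ-∙ τ-τ
  open Homomorphism τ τ-∙

  G : RawGrp
  G = Semidirect H τ

  open RawGrp G using () renaming (Carrier to G-Carrier; _∙_ to _·_; ε to 1G; _⁻¹ to _⁻¹ᴳ)

  N : ℕ → G-Carrier → Set
  N i (h , b) = (b ≡ false ⊎ n < i) × M i h

  module _ (i : ℕ) where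
    open NormalSubgroup (Stage.subgroup (stage i))
    τ-In : TauInvariant (Stage.subgroup (stage i))
    τ-In = Stage.τ-invariant (stage i)

    N-normal : IsNormalSubgroup G (N i)
    N-normal = (inj₁ refl , In-ε) , N-∙ , N-⁻¹ , N-conj
      where
        N-∙ : ∀ a b → N i a → N i b → N i (a · b)
        N-∙ (h , false) (h′ , b′) (_ , h∈) (b′-ok , h′∈) = b′-ok , In-∙ h h′ h∈ h′∈
        N-∙ (h , true)  (h′ , b′) (inj₁ () , _)
        N-∙ (h , true)  (h′ , b′) (inj₂ n<i , h∈) (_ , h′∈) = inj₂ n<i , In-∙ h (τ h′) h∈ (τ-In h′ h′∈)

        N-⁻¹ : ∀ a → N i a → N i (a ⁻¹ᴳ)
        N-⁻¹ (h , false) (b-ok , h∈) = b-ok , In-⁻¹ h h∈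
        N-⁻¹ (h , true)  (b-ok , h∈) = b-ok , τ-In _ (In-⁻¹ h h∈)

        N-conj : ∀ g a → N i a → N i ((g · a) · (g ⁻¹ᴳ))
        N-conj (g , false) (h , false) (_ , h∈) = inj₁ refl , In-conj g h h∈
        N-conj (g , true)  (h , false) (_ , h∈) =
          inj₁ refl , subst (λ z → In ((g ∙ τ h) ∙ z)) (sym (τ-τ (g ⁻¹))) (In-conj g (τ h) (τ-In h h∈))
        N-conj (g , b)     (h , true)  (inj₁ () , _)
        N-conj (g , false) (h , true)  (inj₂ n<i , _) = inj₂ n<i , complete (<⇒≤ n<i) _
        N-conj (g , true)  (h , true)  (inj₂ n<i , _) = inj₂ n<i , complete (<⇒≤ n<i) _

  N-series : IsNormalSeries G (suc n) N
  N-series = N-normal , N₀-trivial , (λ _ → inj₂ ≤-refl , complete (n≤1+n n) _) , N-mono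
    where
      N₀-trivial : ∀ a → N 0 a → a ≡ 1G
      N₀-trivial (h , b) (inj₁ refl , refl) = refl
      N-mono : ∀ i → i < suc n → ∀ a → N i a → N (suc i) a
      N-mono i _ (h , b) (b-ok , h∈) = [ inj₁ , (λ n<i → inj₂ (m<n⇒m<1+n n<i)) ]′ b-ok , M-mono i h h∈

  cyclic-factor : ∀ i → i < suc n → Σ G-Carrier λ c → N (suc i) c ×
    (∀ a → N (suc i) a → Σ _ λ z → N i ((zpow G c z ⁻¹ᴳ) · a))
  cyclic-factor i i<1+n with i <? n
  ... | yes i<n = (gᵢ i , false) , (inj₁ refl , Step.g∈M⟨g⟩ i) , generated
    where
      generated : ∀ a → N (suc i) a → Σ _ λ z → N i ((zpow G (gᵢ i , false) z ⁻¹ᴳ) · a)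
      generated (h , b)     (inj₂ n<1+i , _) = ⊥-elim (<⇒≱ i<n (s≤s⁻¹ n<1+i))
      generated (h , false) (inj₁ refl , (j , gʲ≈h)) =
        + j , subst (N i) (cong (λ c → (c ⁻¹ᴳ) · (h , false)) (sym (semidirect-pow τ (gᵢ i) j))) (inj₁ refl , gʲ≈h)
  ... | no i≮n = (ε , true) , (inj₂ (s≤s n≤i) , complete (m≤n⇒m≤1+n n≤i) _) , generated
    where
      n≤i : n ≤ i
      n≤i = ≮⇒≥ i≮n
      generated : ∀ a → N (suc i) a → Σ _ λ z → N i ((zpow G (ε , true) z ⁻¹ᴳ) · a)
      generated (h , false) _ = + 0 , inj₁ refl , complete n≤i _
      generated (h , true)  _ = + 1 , inj₁ refl , complete n≤i _

  supersolvable : Supersolvable G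
  supersolvable = suc n , N , N-series , cyclic-factor

  module _ (p≡2 : p ≡ 2) (i : ℕ) where
    open NormalSubgroup (Stage.subgroup (stage i))
    open Modulo (Stage.subgroup (stage i))
    open Involution τ τ-∙ τ-τ (Stage.τ-invariant (stage i))
    open Layer (layerᵢ i)

    -- for p = 2 the layer satisfies g² ∈ M, i.e. g ≈ g⁻¹, so τ g ≈ g in both cases
    τ-fixes-layer : τ g ≈ g
    τ-fixes-layer with τ-on-g
    ... | inj₁ τg≈g   = τg≈g
    ... | inj₂ τg≈g⁻¹ = ≈-trans τg≈g⁻¹ (subst (λ z → In (z ∙ g)) (sym (⁻¹-involutive g))
                          (subst In (cong (g ∙_) (identityʳ g)) (subst (λ q → In (pw g q)) p≡2 g^p∈M)))

    commutator-central : ∀ g₁ h → Central h → In (((g₁ ⁻¹ ∙ h ⁻¹) ∙ g₁) ∙ h)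
    commutator-central g₁ h h-central = subst In (begin
      (h ∙ g₁) ⁻¹ ∙ (g₁ ∙ h)           ≡⟨ cong (_∙ (g₁ ∙ h)) (⁻¹-anti-homo-∙ h g₁) ⟩
      (g₁ ⁻¹ ∙ h ⁻¹) ∙ (g₁ ∙ h)        ≡⟨ sym (assoc _ g₁ h) ⟩
      ((g₁ ⁻¹ ∙ h ⁻¹) ∙ g₁) ∙ h        ∎) (≈-sym (h-central g₁))
      where open ≡-Reasoning

    twisted-commutator : ∀ g₁ h → Central h → τ h ≈ h → In (((τ (g₁ ⁻¹) ∙ τ (h ⁻¹)) ∙ τ g₁) ∙ h)
    twisted-commutator g₁ h h-central τh≈h = ε≈⇒In (≈-sym (begin
      ((τ (g₁ ⁻¹) ∙ τ (h ⁻¹)) ∙ τ g₁) ∙ h   ≡⟨ cong (λ z → (z ∙ τ g₁) ∙ h) (τ-∙ (g₁ ⁻¹) (h ⁻¹)) ⟨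
      (τ (g₁ ⁻¹ ∙ h ⁻¹) ∙ τ g₁) ∙ h         ≡⟨ cong (_∙ h) (τ-∙ (g₁ ⁻¹ ∙ h ⁻¹) g₁) ⟨
      τ ((g₁ ⁻¹ ∙ h ⁻¹) ∙ g₁) ∙ h           ≈⟨ ∙-congʳ h (τ-≈ conjugate≈h⁻¹) ⟩
      τ (h ⁻¹) ∙ h                          ≡⟨ cong (_∙ h) (f-⁻¹ h) ⟩
      τ h ⁻¹ ∙ h                            ≈⟨ ∙-congʳ h (⁻¹-cong τh≈h) ⟩
      h ⁻¹ ∙ h                              ≡⟨ inverseˡ h ⟩
      ε                                     ∎))
      where
        open ≈-Reasoning
        c : Carrier
        c = (g₁ ⁻¹ ∙ h ⁻¹) ∙ g₁
        conjugate≈h⁻¹ : c ≈ h ⁻¹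
        conjugate≈h⁻¹ = begin
          c                     ≡⟨ sym (trans (cong (c ∙_) (inverseʳ h)) (identityʳ c)) ⟩
          c ∙ (h ∙ h ⁻¹)        ≡⟨ sym (assoc c h (h ⁻¹)) ⟩
          (c ∙ h) ∙ h ⁻¹        ≈⟨ ∙-congʳ (h ⁻¹) (In⇒≈ε (commutator-central g₁ h h-central)) ⟩
          ε ∙ h ⁻¹              ≡⟨ identityˡ _ ⟩
          h ⁻¹                  ∎

  nilpotent-if-2 : p ≡ 2 → Nilpotent G
  nilpotent-if-2 p≡2 = suc n , N , N-series , central
    where
      central : ∀ i → i < suc n → ∀ g h → N (suc i) h → N i ((((g ⁻¹ᴳ) · (h ⁻¹ᴳ)) · g) · h)
      central i i<1+n g h h∈ with i <? n
      central i _ g       (h , b)     (inj₂ n<1+i , _) | yes i<n = ⊥-elim (<⇒≱ i<n (s≤s⁻¹ n<1+i))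
      central i _ (g , false) (h , .false) (inj₁ refl , h∈) | yes _ =
        inj₁ refl , commutator-central p≡2 i g h (Step.M⟨g⟩-central i h h∈)
      central i _ (g , true)  (h , .false) (inj₁ refl , h∈) | yes _ =
        inj₁ refl , twisted-commutator p≡2 i g h (Step.M⟨g⟩-central i h h∈)
                      (Step.M⟨g⟩-τ-fixed i (τ-fixes-layer p≡2 i) h h∈)
      central i _ (g , false) (h , false) _ | no i≮n = inj₁ refl , complete (≮⇒≥ i≮n) _
      central i _ (g , false) (h , true)  _ | no i≮n = inj₁ refl , complete (≮⇒≥ i≮n) _
      central i _ (g , true)  (h , false) _ | no i≮n = inj₁ refl , complete (≮⇒≥ i≮n) _
      central i _ (g , true)  (h , true)  _ | no i≮n = inj₁ refl , complete (≮⇒≥ i≮n) _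

-- The map F h = τ(h)⁻¹ h realises the commutator [τ, h], and it satisfies
-- F (F h) = (F h)²; since squaring is invertible (x = (x²)ᵐ with 2m = n+1),
-- every F h lies in every term of a central series, hence in N 0 = 1, which
-- would force τ = 1.
module NonNilpotent (H : Grp)
  (τ : Grp.Carrier H → Grp.Carrier H) (τ-∙ : ∀ a b → τ (Grp._∙_ H a b) ≡ Grp._∙_ H (τ a) (τ b))
  (τ-τ : ∀ a → τ (τ a) ≡ a)
  (n : ℕ) (exponent : ∀ a → GroupFacts.pw H a n ≡ Grp.ε H) (m : ℕ) (n+1≡m*2 : n + 1 ≡ m * 2) where
  open import Data.Nat using (ℕ; zero; suc; _+_; _*_; _<_; s≤s)
  open import Data.Nat.Properties using (+-suc; +-identityʳ; m≤n+m; *-comm)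
  open import Data.Bool using (true; false)
  open import Data.Product
  open import Relation.Binary.PropositionalEquality

  open GroupFacts H
  open Homomorphism τ τ-∙
  open ≡-Reasoning

  G : RawGrp
  G = Semidirect H τ

  open RawGrp G using () renaming (_∙_ to _·_; _⁻¹ to _⁻¹ᴳ)

  F : Carrier → Carrier
  F h = τ h ⁻¹ ∙ h

  commutator-τ : ∀ h → (((ε , true) ⁻¹ᴳ · ((h , false) ⁻¹ᴳ)) · (ε , true)) · (h , false) ≡ (F h , false)
  commutator-τ h = cong (λ c → (c ∙ h , false)) (begin
    (τ (ε ⁻¹) ∙ τ (h ⁻¹)) ∙ τ ε    ≡⟨ cong₂ (λ a b → (a ∙ τ (h ⁻¹)) ∙ b)
                                             (trans (cong τ ε⁻¹≡ε) f-ε) f-ε ⟩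
    (ε ∙ τ (h ⁻¹)) ∙ ε             ≡⟨ trans (identityʳ _) (identityˡ _) ⟩
    τ (h ⁻¹)                       ≡⟨ f-⁻¹ h ⟩
    τ h ⁻¹                         ∎)

  F-twice : ∀ h → F (F h) ≡ F h ∙ F h
  F-twice h = begin
    τ (F h) ⁻¹ ∙ F h                 ≡⟨ cong (λ z → z ⁻¹ ∙ F h) τ-F ⟩
    (h ⁻¹ ∙ τ h) ⁻¹ ∙ F h            ≡⟨ cong (_∙ F h) (⁻¹-anti-homo-∙ (h ⁻¹) (τ h)) ⟩
    (τ h ⁻¹ ∙ (h ⁻¹) ⁻¹) ∙ F h       ≡⟨ cong (λ z → (τ h ⁻¹ ∙ z) ∙ F h) (⁻¹-involutive h) ⟩
    F h ∙ F h                        ∎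
    where
      τ-F : τ (F h) ≡ h ⁻¹ ∙ τ h
      τ-F = begin
        τ (τ h ⁻¹ ∙ h)               ≡⟨ τ-∙ (τ h ⁻¹) h ⟩
        τ (τ h ⁻¹) ∙ τ h             ≡⟨ cong (_∙ τ h) (f-⁻¹ (τ h)) ⟩
        τ (τ h) ⁻¹ ∙ τ h             ≡⟨ cong (λ z → z ⁻¹ ∙ τ h) (τ-τ h) ⟩
        h ⁻¹ ∙ τ h                   ∎

  -- squaring is invertible: (a²)ᵐ = a ^ (n + 1) = a
  halve : ∀ a → pw (a ∙ a) m ≡ a
  halve a = begin
    pw (a ∙ a) m         ≡⟨ cong (λ z → pw (a ∙ z) m) (sym (identityʳ a)) ⟩
    pw (pw a 2) m        ≡⟨ sym (pow-mul a 2 m) ⟩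
    pw a (2 * m)         ≡⟨ cong (pw a) (trans (*-comm 2 m) (sym n+1≡m*2)) ⟩
    pw a (n + 1)         ≡⟨ pow-add a n 1 ⟩
    pw a n ∙ (a ∙ ε)     ≡⟨ cong₂ _∙_ (exponent a) (identityʳ a) ⟩
    ε ∙ a                ≡⟨ identityˡ a ⟩
    a                    ∎

  nilpotent⇒τ-trivial : Nilpotent G → ∀ h → τ h ≡ h
  nilpotent⇒τ-trivial (s , N , (N-normal , N₀-trivial , N-top , _) , central) h =
    sym (trans (inverseʳ-unique (τ h ⁻¹) h Fh≡ε) (⁻¹-involutive (τ h)))
    where
      N-pow : ∀ i a j → N i a → N i (pow G a j)
      N-pow i a zero    _   = proj₁ (N-normal i)
      N-pow i a (suc j) a∈N = proj₁ (proj₂ (N-normal i)) a _ a∈N (N-pow i a j a∈N)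
      descend : ∀ j i → j + i ≡ s → ∀ h → N i (F h , false)
      descend zero    i refl h = N-top _
      descend (suc j) i j+1+i≡s h =
        subst (N i) (cong (_, false) (halve (F h)))
          (subst (N i) (semidirect-pow τ (F h ∙ F h) m)
            (N-pow i _ m (subst (N i) (trans (commutator-τ (F h)) (cong (_, false) (F-twice h)))
              (central i i<s (ε , true) (F h , false) (descend j (suc i) (trans (+-suc j i) j+1+i≡s) h)))))
        where
          i<s : i < s
          i<s = subst (i <_) j+1+i≡s (s≤s (m≤n+m i j))
      Fh≡ε : F h ≡ ε
      Fh≡ε = cong proj₁ (N₀-trivial _ (descend s 0 (+-identityʳ s) h))

module Abelian where
  open import Data.Nat using (ℕ; zero; suc; s≤s; _<_)
  open import Data.Unit using (⊤; tt)
  open import Data.Product using (_,_)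
  open import Function.Bundles using (Inverse)
  open import Relation.Binary.PropositionalEquality

  module _ (A : Grp) (comm : ∀ a b → Grp._∙_ A a b ≡ Grp._∙_ A b a) where
    open GroupFacts A
    open ≡-Reasoning

    commutator-trivial : ∀ g h → ((g ⁻¹ ∙ h ⁻¹) ∙ g) ∙ h ≡ ε
    commutator-trivial g h = begin
      ((g ⁻¹ ∙ h ⁻¹) ∙ g) ∙ h    ≡⟨ cong (_∙ h) (assoc _ _ _) ⟩
      (g ⁻¹ ∙ (h ⁻¹ ∙ g)) ∙ h    ≡⟨ cong (λ x → (g ⁻¹ ∙ x) ∙ h) (comm (h ⁻¹) g) ⟩
      (g ⁻¹ ∙ (g ∙ h ⁻¹)) ∙ h    ≡⟨ cong (_∙ h) (⁻¹-cancelˡ g (h ⁻¹)) ⟩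
      h ⁻¹ ∙ h                   ≡⟨ inverseˡ h ⟩
      ε                          ∎

    nilpotent : Nilpotent raw
    nilpotent = 1 , series , (normal , (λ _ a≡ε → a≡ε) , (λ _ → tt) , mono) , central
      where
        series : ℕ → Carrier → Set
        series zero    a = a ≡ ε
        series (suc _) a = ⊤
        normal : ∀ i → IsNormalSubgroup raw (series i)
        normal zero    = trivial-normal
        normal (suc _) = tt , (λ _ _ _ _ → tt) , (λ _ _ → tt) , (λ _ _ _ → tt)
        mono : ∀ i → i < 1 → ∀ a → series i a → series (suc i) a
        mono zero _ _ _ = tt
        mono (suc _) (s≤s ())
        central : ∀ i → i < 1 → ∀ g h → series (suc i) h → series i (((g ⁻¹ ∙ h ⁻¹) ∙ g) ∙ h)
        central zero _ g h _ = commutator-trivial g h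
        central (suc _) (s≤s ())

  ≅-commutative : (K A : RawGrp) → K ≅ A → (∀ a b → RawGrp._∙_ A a b ≡ RawGrp._∙_ A b a) →
    ∀ a b → RawGrp._∙_ K a b ≡ RawGrp._∙_ K b a
  ≅-commutative K A (f , f-∙) comm a b = begin
    a ·ₖ b                   ≡⟨ from-to (a ·ₖ b) ⟨
    from (to (a ·ₖ b))       ≡⟨ cong from (trans (f-∙ a b) (trans (comm (to a) (to b)) (sym (f-∙ b a)))) ⟩
    from (to (b ·ₖ a))       ≡⟨ from-to (b ·ₖ a) ⟩
    b ·ₖ a                   ∎
    where
      open ≡-Reasoning
      open Inverse f using (to; from)
      open RawGrp K using () renaming (_∙_ to _·ₖ_)
      from-to : ∀ x → from (to x) ≡ x
      from-to x = Inverse.inverseʳ f refl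

-- Elements are
-- compared through their ℕ-value V x ∈ [0, d) and their Bool component.
module CyclicTimesZ2 (m : ℕ) where
  open import Data.Nat
  open import Data.Nat.Properties
  open import Data.Nat.DivMod
  open import Data.Fin using (Fin; toℕ)
  import Data.Fin.Properties as Fin
  open import Data.Bool using (true; false)
  open import Data.Bool.Properties using (xor-assoc; xor-comm; xor-identityʳ; xor-same)
  open import Data.Integer using (+_)
  open import Data.Unit using (⊤; tt)
  open import Data.Product
  open import Relation.Binary.PropositionalEquality

  d : ℕ
  d = suc m

  open RawGrp (CycZ2 m)
  open ≡-Reasoning

  V : Carrier → ℕ
  V (a , _) = toℕ a

  V-mod : ∀ x → toℕ (x mod d) ≡ x % d
  V-mod x = Fin.toℕ-fromℕ< (m%n<n x d)

  V-small : ∀ x → V x % d ≡ V x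
  V-small (a , _) = m<n⇒m%n≡m (Fin.toℕ<n a)

  V-∙ : ∀ x y → V (x ∙ y) ≡ (V x + V y) % d
  V-∙ (a , _) (b , _) = V-mod (toℕ a + toℕ b)

  V-⁻¹ : ∀ x → V (x ⁻¹) ≡ (d ∸ V x) % d
  V-⁻¹ (a , _) = V-mod (d ∸ toℕ a)

  V-ε : V ε ≡ 0
  V-ε = V-mod 0

  complement : ∀ x → (d ∸ V x) + V x ≡ d
  complement (a , _) = m∸n+n≡m (<⇒≤ (Fin.toℕ<n a))

  ≡-by-V : ∀ {x y} → V x ≡ V y → proj₂ x ≡ proj₂ y → x ≡ y
  ≡-by-V {a , _} {b , _} Va≡Vb s≡t = cong₂ _,_ (Fin.toℕ-injective Va≡Vb) s≡t

  %-absorbˡ : ∀ x y → (x % d + y) % d ≡ (x + y) % d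
  %-absorbˡ x y = begin
    (x % d + y) % d              ≡⟨ %-distribˡ-+ (x % d) y d ⟩
    (x % d % d + y % d) % d      ≡⟨ cong (λ z → (z + y % d) % d) (m%n%n≡m%n x d) ⟩
    (x % d + y % d) % d          ≡⟨ %-distribˡ-+ x y d ⟨
    (x + y) % d                  ∎

  %-absorbʳ : ∀ x y → (x + y % d) % d ≡ (x + y) % d
  %-absorbʳ x y = trans (cong (_% d) (+-comm x (y % d))) (trans (%-absorbˡ y x) (cong (_% d) (+-comm y x)))

  ∙-comm : ∀ x y → x ∙ y ≡ y ∙ x
  ∙-comm (a , s) (b , t) = cong₂ _,_ (cong (_mod d) (+-comm (toℕ a) (toℕ b))) (xor-comm s t)

  ℤ⊕ℤ₂ : Grp
  ℤ⊕ℤ₂ = record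
    { raw = CycZ2 m
    ; assoc = λ x y z → ≡-by-V (assoc-V x y z) (xor-assoc (proj₂ x) (proj₂ y) (proj₂ z))
    ; identityˡ = λ x → ≡-by-V (identityˡ-V x) refl
    ; identityʳ = λ x → ≡-by-V (identityʳ-V x) (xor-identityʳ (proj₂ x))
    ; inverseˡ = λ x → ≡-by-V (inverseˡ-V x) (xor-same (proj₂ x))
    ; inverseʳ = λ x → ≡-by-V (trans (cong V (∙-comm x (x ⁻¹))) (inverseˡ-V x)) (xor-same (proj₂ x)) }
    where
      assoc-V : ∀ x y z → V ((x ∙ y) ∙ z) ≡ V (x ∙ (y ∙ z))
      assoc-V x y z = begin
        V ((x ∙ y) ∙ z)             ≡⟨ trans (V-∙ (x ∙ y) z) (cong (λ u → (u + V z) % d) (V-∙ x y)) ⟩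
        ((V x + V y) % d + V z) % d ≡⟨ %-absorbˡ (V x + V y) (V z) ⟩
        (V x + V y + V z) % d       ≡⟨ cong (_% d) (+-assoc (V x) (V y) (V z)) ⟩
        (V x + (V y + V z)) % d     ≡⟨ %-absorbʳ (V x) (V y + V z) ⟨
        (V x + (V y + V z) % d) % d ≡⟨ sym (trans (V-∙ x (y ∙ z)) (cong (λ u → (V x + u) % d) (V-∙ y z))) ⟩
        V (x ∙ (y ∙ z))             ∎
      identityˡ-V : ∀ x → V (ε ∙ x) ≡ V x
      identityˡ-V x = trans (V-∙ ε x) (trans (cong (λ u → (u + V x) % d) V-ε) (V-small x))
      identityʳ-V : ∀ x → V (x ∙ ε) ≡ V x
      identityʳ-V x = trans (cong V (∙-comm x ε)) (identityˡ-V x)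
      inverseˡ-V : ∀ x → V (x ⁻¹ ∙ x) ≡ V ε
      inverseˡ-V x = begin
        V (x ⁻¹ ∙ x)                ≡⟨ trans (V-∙ (x ⁻¹) x) (cong (λ u → (u + V x) % d) (V-⁻¹ x)) ⟩
        ((d ∸ V x) % d + V x) % d   ≡⟨ %-absorbˡ (d ∸ V x) (V x) ⟩
        ((d ∸ V x) + V x) % d       ≡⟨ cong (_% d) (complement x) ⟩
        d % d                       ≡⟨ trans (n%n≡0 d) (sym V-ε) ⟩
        V ε                         ∎

  generator : Carrier
  generator = (1 mod d , false)

  V-pow : ∀ j → V (pow (CycZ2 m) generator j) ≡ j % d
  V-pow zero    = V-ε
  V-pow (suc j) = begin
    V (generator ∙ pow (CycZ2 m) generator j)   ≡⟨ V-∙ generator (pow (CycZ2 m) generator j) ⟩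
    (V generator + V (pow (CycZ2 m) generator j)) % d
                                                ≡⟨ cong₂ (λ u w → (u + w) % d) (V-mod 1) (V-pow j) ⟩
    (1 % d + j % d) % d                         ≡⟨ %-distribˡ-+ 1 j d ⟨
    suc j % d                                   ∎

  pow-generator : ∀ a → pow (CycZ2 m) generator (toℕ a) ≡ (a , false)
  pow-generator a = ≡-by-V (trans (V-pow (toℕ a)) (V-small (a , false))) (bool (toℕ a))
    where
      bool : ∀ j → proj₂ (pow (CycZ2 m) generator j) ≡ false
      bool zero    = refl
      bool (suc j) = bool j

  series : ℕ → Carrier → Set
  series zero          x = x ≡ ε
  series (suc zero)    x = proj₂ x ≡ false
  series (suc (suc _)) x = ⊤

  supersolvable : Supersolvable (CycZ2 m)
  supersolvable = 2 , series , (normal , (λ _ x≡ε → x≡ε) , (λ _ → tt) , mono) , cyclic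
    where
      open GroupFacts ℤ⊕ℤ₂ using (trivial-normal)
      normal : ∀ i → IsNormalSubgroup (CycZ2 m) (series i)
      normal zero          = trivial-normal
      normal (suc zero)    = refl , (λ { (_ , false) (_ , false) refl refl → refl }) , (λ { (_ , false) refl → refl })
                           , (λ { (_ , false) (_ , false) refl → refl ; (_ , true) (_ , false) refl → refl })
      normal (suc (suc _)) = tt , (λ _ _ _ _ → tt) , (λ _ _ → tt) , (λ _ _ _ → tt)
      mono : ∀ i → i < 2 → ∀ x → series i x → series (suc i) x
      mono zero       _ _ refl = refl
      mono (suc zero) _ _ _    = tt
      mono (suc (suc _)) (s≤s (s≤s ()))
      cyclic : ∀ i → i < 2 → Σ Carrier λ c → series (suc i) c ×
                 (∀ x → series (suc i) x → Σ _ λ z → series i ((zpow (CycZ2 m) c z ⁻¹) ∙ x))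
      cyclic zero _ = generator , refl , λ { (a , .false) refl →
        + toℕ a , trans (cong (λ c → (c ⁻¹) ∙ (a , false)) (pow-generator a)) (Grp.inverseˡ ℤ⊕ℤ₂ (a , false)) }
      cyclic (suc zero) _ = (0 mod d , true) , tt , λ { (a , false) _ → + 0 , refl ; (a , true) _ → + 1 , refl }
      cyclic (suc (suc _)) (s≤s (s≤s ()))

open import Data.Nat using (nonTrivial⇒n>1)
open import Data.Nat.Properties using (_≟_; ≤∧≢⇒<)
open import Data.Nat.Primality using (prime⇒nonTrivial)
open import Data.Nat.Divisibility using (divides)
open import Data.Bool using (true; false)
open import Data.Product using (_,_; proj₁; proj₂)
open import Data.Sum using (inj₁; inj₂)
open import Data.Empty using (⊥-elim)
open import Relation.Nullary using (¬_; yes; no)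
open import Relation.Binary.PropositionalEquality using (refl; sym; trans; cong)
open import Function using (_∘_; id)
open import Function.Bundles using (mk⇔)
open import Function.Construct.Identity using (↔-id)
open Arithmetic

Criterion : ℕ → RawGrp → Set
Criterion p G = p ≡ 2 ⊎ (p > 2 × Σ ℕ (λ e → IsoCycZ2 G (p ^ e)))

odd-prime-gt-2 : ∀ {p} → Prime p → p ≢ 2 → p > 2
odd-prime-gt-2 {p} p-prime p≢2 = ≤∧≢⇒< (nonTrivial⇒n>1 p {{prime⇒nonTrivial p-prime}}) (p≢2 ∘ sym)

-- Case x = y: G = ℤ_m ⊕ ℤ_2 with m = o(x).  It is abelian, hence
-- supersolvable and nilpotent, and m divides |H| = p ^ k, so m is a power of p.
cyclic-case : ∀ {p} → Prime p → (H : Grp) (k : ℕ) → (Grp.Carrier H ↔ Fin (p ^ k)) →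
  (x : Grp.Carrier H) (m : ℕ) → IsOrder H x (suc m) →
  Supersolvable (CycZ2 m) × (Nilpotent (CycZ2 m) ⇔ Criterion p (CycZ2 m))
cyclic-case {p} p-prime H k enum x m o[x]≡m+1 =
  CyclicTimesZ2.supersolvable m , mk⇔ (λ _ → criterion) (λ _ → Abelian.nilpotent ℤ⊕ℤ₂ ∙-comm)
  where
    open CyclicTimesZ2 m using (ℤ⊕ℤ₂; ∙-comm)
    m+1≡pᵉ : Σ ℕ λ e → suc m ≡ p ^ e
    m+1≡pᵉ = prime-power-divisor p-prime k (suc m)
      (GroupFacts.order-divides H (p ^ k) o[x]≡m+1 (FiniteGroups.pow-card H (p ^ k) enum x))
    criterion : Criterion p (CycZ2 m)
    criterion with p ≟ 2
    ... | yes p≡2 = inj₁ p≡2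
    ... | no p≢2  = inj₂ (odd-prime-gt-2 p-prime p≢2 , proj₁ m+1≡pᵉ , m , proj₂ m+1≡pᵉ , ↔-id _ , λ _ _ → refl)

semidirect-noncommutative : (H : Grp) (τ : Grp.Carrier H → Grp.Carrier H) →
  (∀ a b → τ (Grp._∙_ H a b) ≡ Grp._∙_ H (τ a) (τ b)) → (h : Grp.Carrier H) → τ h ≢ h →
  ¬ (∀ a b → RawGrp._∙_ (Semidirect H τ) a b ≡ RawGrp._∙_ (Semidirect H τ) b a)
semidirect-noncommutative H τ τ-∙ h τh≢h comm =
  τh≢h (sym (trans (sym (identityʳ h)) (trans (cong proj₁ (comm (h , false) (ε , true))) (identityˡ (τ h)))))
  where open GroupFacts H

semidirect-case : ∀ {p} → Prime p → (H : Grp) (k : ℕ) → (enum : Grp.Carrier H ↔ Fin (p ^ k)) →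
  (τ : Grp.Carrier H → Grp.Carrier H) (τ-∙ : ∀ a b → τ (Grp._∙_ H a b) ≡ Grp._∙_ H (τ a) (τ b)) →
  (∀ a → τ (τ a) ≡ a) → (h : Grp.Carrier H) → τ h ≢ h →
  Supersolvable (Semidirect H τ) × (Nilpotent (Semidirect H τ) ⇔ Criterion p (Semidirect H τ))
semidirect-case {p} p-prime H k enum τ τ-∙ τ-τ h τh≢h =
  supersolvable , mk⇔ nilpotent⇒criterion criterion⇒nilpotent
  where
    open ExtendedGroup H p-prime k enum τ τ-∙ τ-τ using (supersolvable; nilpotent-if-2)
    nilpotent⇒criterion : Nilpotent (Semidirect H τ) → Criterion p (Semidirect H τ)
    nilpotent⇒criterion nilpotent with p ≟ 2
    ... | yes p≡2 = inj₁ p≡2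
    ... | no p≢2 with odd-power-plus-one (odd-prime p-prime p≢2) k
    ...   | divides m pᵏ+1≡m*2 = ⊥-elim (τh≢h (NonNilpotent.nilpotent⇒τ-trivial H τ τ-∙ τ-τ
              (p ^ k) (FiniteGroups.pow-card H (p ^ k) enum) m pᵏ+1≡m*2 nilpotent h))
    criterion⇒nilpotent : Criterion p (Semidirect H τ) → Nilpotent (Semidirect H τ)
    criterion⇒nilpotent (inj₁ p≡2) = nilpotent-if-2 p≡2
    criterion⇒nilpotent (inj₂ (_ , _ , m , _ , G≅ℤ⊕ℤ₂)) = ⊥-elim (semidirect-noncommutative H τ τ-∙ h τh≢h
      (Abelian.≅-commutative (Semidirect H τ) (CycZ2 m) G≅ℤ⊕ℤ₂ (CyclicTimesZ2.∙-comm m)))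

proposition5p3 :
    (p : ℕ) → Prime p →
    (H : Grp) → (k : ℕ) → (Grp.Carrier H ↔ Fin (p ^ k)) →
    (x y : Grp.Carrier H) → Generates H x y →
    (τ : Grp.Carrier H → Grp.Carrier H) → IsAutomorphism H τ →
    τ x ≡ y → τ y ≡ x →
    ((x ≡ y → (m : ℕ) → IsOrder H x (suc m) →
        Supersolvable (CycZ2 m) ×
        (Nilpotent (CycZ2 m) ⇔
          (p ≡ 2 ⊎ (p > 2 × Σ ℕ (λ e → IsoCycZ2 (CycZ2 m) (p ^ e)))))) ×
     (x ≢ y →
        Supersolvable (Semidirect H τ) ×
        (Nilpotent (Semidirect H τ) ⇔
          (p ≡ 2 ⊎ (p > 2 × Σ ℕ (λ e → IsoCycZ2 (Semidirect H τ) (p ^ e)))))))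
proposition5p3 p p-prime H k enum x y generates τ (τ-∙ , _) τx≡y τy≡x =
  (λ _ m o[x]≡m+1 → cyclic-case p-prime H k enum x m o[x]≡m+1) ,
  (λ x≢y → semidirect-case p-prime H k enum τ τ-∙ τ-τ x (λ τx≡x → x≢y (trans (sym τx≡x) τx≡y)))
  where
    -- τ² agrees with the identity on the generators x and y, hence everywhere
    τ-τ : ∀ a → τ (τ a) ≡ a
    τ-τ = GroupFacts.endomorphisms-agree H x y generates (τ ∘ τ) id
            (λ a b → trans (cong τ (τ-∙ a b)) (τ-∙ (τ a) (τ b))) (λ _ _ → refl)
            (trans (cong τ τx≡y) τy≡x) (trans (cong τ τy≡x) τx≡y)
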